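{- Let $X=\{X_1,X_2\}$ be a $\lambda_2$-equitable $2$-partition of $J(n,3)$ with quotient matrix $(p_{ij})$ satisfying $p_{11}\geq p_{22}$ and $p_{11}\geq 2n-7$. Let $\{a,b,c\}$ be a vertex with $\overline{abc}=1$ and $\overline{ab\ast}=\overline{ac\ast}=\overline{bc\ast}$. For $d\in[n]\setminus\{a,b,c\}$ let $C_d=(\overline{abd},\overline{acd},\overline{bcd})$, and call $C_d$ constant if it is $(1,1,1)$ or $(0,0,0)$. Then one of the following holds: (i) every $C_d$ is constant; (ii) there are distinct $d,e$ such that $C_d$ has exactly two entries equal to $1$, $C_e$ is the complement of $C_d$ (i.e. $C_e=(1,1,1)-C_d$), and all other $C_f$ are constant; (iii) there are distinct $d,e,f$ with $C_d=(1,0,0)$, $C_e=(0,1,0)$, $C_f=(0,0,1)$, and all other $C_g$ are constant; (iv) there are distinct $d,e,f$ with $C_d=(1,1,0)$, $C_e=(1,0,1)$, $C_f=(0,1,1)$, and all other $C_g$ are constant.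
   Context: $J(n,3)$ ($n\geq 6$): vertices are the $3$-subsets of $[n]$, adjacent iff they share exactly two elements; it is $3(n-3)$-regular. An equitable $2$-partition with quotient matrix $(p_{ij})$ means each vertex of $X_i$ has exactly $p_{ij}$ neighbours in $X_j$; $\lambda_2$-equitable means $p_{11}-p_{21}=n-7$. $\overline{u}=1$ if $u\in X_1$, else $0$; $\overline{xyz}=\overline{\{x,y,z\}}$; $\overline{ij\ast}$ is the number of $3$-subsets containing $i,j$ lying in $X_1$. -}

module Defs where

open import Data.Nat using (ℕ; zero; suc; _+_; _≡ᵇ_)
open import Data.Bool using (Bool; true; false; _∧_; not; _xor_; if_then_else_)
open import Data.List using (List; []; _∷_; _++_; map)
open import Data.Fin using (Fin; toℕ)
open import Data.Fin.Subset using (Subset; _∪_; _∩_; ⁅_⁆; ∣_∣; inside; outside; _∉_)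
open import Data.Vec using (Vec; []; _∷_)
open import Data.List using (allFin)
open import Data.Product using (_×_; _,_; ∃)
open import Data.Sum using (_⊎_)
open import Relation.Binary.PropositionalEquality using (_≡_; _≢_)

allSubsets : (n : ℕ) → List (Subset n)
allSubsets zero = [] ∷ []
allSubsets (suc n) = map (inside ∷_) (allSubsets n) ++ map (outside ∷_) (allSubsets n)

countB : {A : Set} → (A → Bool) → List A → ℕ
countB p [] = 0
countB p (x ∷ xs) = (if p x then 1 else 0) + countB p xs

isVertex : {n : ℕ} → Subset n → Bool
isVertex s = ∣ s ∣ ≡ᵇ 3

adjacent : {n : ℕ} → Subset n → Subset n → Bool
adjacent u v = ∣ u ∩ v ∣ ≡ᵇ 2

-- A 2-partition of V(J(n,3)) is given by the indicator χ of X₁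
-- (χ v ≡ true ↔ v ∈ X₁; χ v ≡ false ↔ v ∈ X₂; values on non-3-subsets irrelevant).
nbrsIn : {n : ℕ} → (Subset n → Bool) → Bool → Subset n → ℕ
nbrsIn {n} χ b u =
  countB (λ v → isVertex v ∧ adjacent u v ∧ not (χ v xor b)) (allSubsets n)

IsTwoPartition : {n : ℕ} → (Subset n → Bool) → Set
IsTwoPartition {n} χ =
  (∃ λ (v : Subset n) → ∣ v ∣ ≡ 3 × χ v ≡ true) ×
  (∃ λ (v : Subset n) → ∣ v ∣ ≡ 3 × χ v ≡ false)

IsEquitable : {n : ℕ} → (Subset n → Bool) → ℕ → ℕ → ℕ → ℕ → Set
IsEquitable {n} χ p11 p12 p21 p22 =
  ((u : Subset n) → ∣ u ∣ ≡ 3 → χ u ≡ true →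
     nbrsIn χ true u ≡ p11 × nbrsIn χ false u ≡ p12) ×
  ((u : Subset n) → ∣ u ∣ ≡ 3 → χ u ≡ false →
     nbrsIn χ true u ≡ p21 × nbrsIn χ false u ≡ p22)

triple : {n : ℕ} → Fin n → Fin n → Fin n → Subset n
triple x y z = ⁅ x ⁆ ∪ ⁅ y ⁆ ∪ ⁅ z ⁆

-- \overline{ij*}: number of 3-subsets containing i,j lying in X₁ (for i ≠ j)
pairCount : {n : ℕ} → (Subset n → Bool) → Fin n → Fin n → ℕ
pairCount {n} χ i j =
  countB (λ k → not (toℕ k ≡ᵇ toℕ i) ∧ not (toℕ k ≡ᵇ toℕ j) ∧ χ (triple i j k)) (allFin n)

Bool³ : Set
Bool³ = Bool × Bool × Bool

C : {n : ℕ} → (Subset n → Bool) → Fin n → Fin n → Fin n → Fin n → Bool³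
C χ a b c d = χ (triple a b d) , χ (triple a c d) , χ (triple b c d)

Constant : Bool³ → Set
Constant t = (t ≡ (true , true , true)) ⊎ (t ≡ (false , false , false))

TwoOnes : Bool³ → Set
TwoOnes t = (t ≡ (true , true , false)) ⊎ (t ≡ (true , false , true)) ⊎ (t ≡ (false , true , true))

complement³ : Bool³ → Bool³
complement³ (x , y , z) = not x , not y , not z

Outside3 : {n : ℕ} → Fin n → Fin n → Fin n → Fin n → Set
Outside3 a b c d = d ≢ a × d ≢ b × d ≢ c

-- Write xy* for the number of 3-subsets through {x,y} lying in X₁, and K = n − 4, so that
-- p₁₁ + 3 = p₂₁ + K.  Double counting the neighbours of a vertex {x,y,z} gives
-- nbrs + 3·[xyz ∈ X₁] = xy* + xz* + yz*, hence by equitability xy* + xz* + yz* = p₂₁ + K·[xyz ∈ X₁];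
-- at {a,b,c} this is 3s = p₂₁ + K for the common pair count s.  For d ∉ {a,b,c} the same equations
-- at {a,b,d}, {a,c,d}, {b,c,d} show: if C_d has a single 1, the pair count of d with the odd
-- element of {a,b,c} is s − K; if C_d has two 1's, that pair count is the maximum n − 2 and
-- 2s = K + 4.  So when s = K a single pattern and its complement cannot both occur.  Sorting the
-- points d by their pattern turns ab*, ac*, bc* and n − 3 into linear equations in the eight
-- pattern counts.  Without two-1 patterns these force the three single counts to be equal and at
-- most 1; with one, 2s = K + 4 and 3s ≥ 2K + 4 give K ≤ 4, and the finitely many remaining count
-- vectors are checked by evaluation.

module Submission where

open import Data.Nat.Properties
open import Algebra.Properties.CommutativeSemigroup +-commutativeSemigroup using (x∙yz≈y∙xz; xy∙z≈xz∙y; interchange)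
open import Algebra.Properties.CommutativeSemigroup *-commutativeSemigroup using () renaming (x∙yz≈y∙xz to *-swap)
open import Algebra.Properties.Semiring.Sum +-*-semiring
  using (sum; sum-syntax; ∑-distrib-+; *-distribˡ-sum; *-distribʳ-sum; sum-cong-≗)
open import Data.Bool using (Bool; true; false; _∧_; _∨_; not; _xor_; if_then_else_; T)
open import Data.Bool.Properties using (not-injective; ∧-zeroʳ; ∧-identityʳ; ∧-assoc; T-∧)
open import Data.Empty using (⊥)
open import Data.Fin using (Fin; zero; suc; toℕ)
open import Data.Fin.Subset using (Subset; _∪_; _∩_; ⁅_⁆; ∣_∣; inside; outside)
open import Data.Fin.Subset.Properties using (∪-comm; ∪-assoc; ∩-idem)
open import Data.List using (List; []; _∷_; _++_; map; allFin; tabulate)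
open import Data.Maybe using (Maybe; just; nothing; is-just; to-witness-T)
open import Data.Nat using (ℕ; zero; suc; pred; _+_; _*_; _∸_; _≤_; _<_; _≟_; _≤?_; _≡ᵇ_; z≤n; s≤s)
open import Data.Nat.Tactic.RingSolver using (solve-∀)
open import Data.Product using (_×_; _,_; ∃; proj₁; proj₂)
open import Data.Sum using (_⊎_; inj₁; inj₂)
open import Data.Unit using (tt)
open import Data.Vec as Vec using (Vec; []; _∷_; lookup)
open import Data.Vec.Properties using (lookup-zipWith; lookup-replicate)
open import Function using (_∘_)
open import Function.Bundles using (Equivalence)
open import Relation.Binary.PropositionalEquality
open import Relation.Nullary using (Dec; does; contradiction)
open import Relation.Nullary.Decidable using (_×-dec_; _⊎-dec_; _→-dec_; dec-true)
open import Defs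

-- Arithmetic of the vertex equations and of the pattern counts

-- α, β, γ stand for the pair counts of d with a, b, c; the hypotheses are the vertex equations of
-- {a,b,d}, {a,c,d}, {b,c,d}, with right-hand side q + K for a vertex in X₁ and q for one in X₂.
module _ (s q K α β γ : ℕ) (triangle : 3 * s ≡ q + K) where

  single-vertex : s + α + γ ≡ q → s + β + γ ≡ q → s + α + β ≡ q + K → γ + K ≡ s
  single-vertex αγ βγ αβ = *-cancelˡ-≡ (γ + K) s 2 (+-cancelʳ-≡ common _ _ (begin
    2 * (γ + K) + common
      ≡⟨ cong (λ x → 2 * (γ + K) + (q + q + x + 3 * s)) αβ ⟨
    2 * (γ + K) + (q + q + (s + α + β) + 3 * s)
      ≡⟨ regroup s q K α β γ ⟩
    2 * s + ((s + α + γ) + (s + β + γ) + (q + K) + (q + K))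
      ≡⟨ cong₂ (λ x y → 2 * s + (x + y + (q + K) + (q + K))) αγ βγ ⟩
    2 * s + (q + q + (q + K) + (q + K))
      ≡⟨ cong (λ x → 2 * s + (q + q + (q + K) + x)) triangle ⟨
    2 * s + common ∎))
    where
    open ≡-Reasoning
    common = q + q + (q + K) + 3 * s
    regroup : ∀ s q K α β γ → 2 * (γ + K) + (q + q + (s + α + β) + 3 * s)
                            ≡ 2 * s + ((s + α + γ) + (s + β + γ) + (q + K) + (q + K))
    regroup = solve-∀

  double-vertex : s + α + β ≡ q → s + α + γ ≡ q + K → s + β + γ ≡ q + K → 2 * γ ≡ 2 * s + K
  double-vertex αβ αγ βγ = +-cancelʳ-≡ common _ _ (begin
    2 * γ + common
      ≡⟨ cong (λ x → 2 * γ + ((q + K) + (q + K) + x + 3 * s)) αβ ⟨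
    2 * γ + ((q + K) + (q + K) + (s + α + β) + 3 * s)
      ≡⟨ regroup s q K α β γ ⟩
    (2 * s + K) + ((s + α + γ) + (s + β + γ) + q + (q + K))
      ≡⟨ cong₂ (λ x y → (2 * s + K) + (x + y + q + (q + K))) αγ βγ ⟩
    (2 * s + K) + ((q + K) + (q + K) + q + (q + K))
      ≡⟨ cong (λ x → (2 * s + K) + ((q + K) + (q + K) + q + x)) triangle ⟨
    (2 * s + K) + common ∎)
    where
    open ≡-Reasoning
    common = (q + K) + (q + K) + q + 3 * s
    regroup : ∀ s q K α β γ → 2 * γ + ((q + K) + (q + K) + (s + α + β) + 3 * s)
                            ≡ (2 * s + K) + ((s + α + γ) + (s + β + γ) + q + (q + K))
    regroup = solve-∀

double-saturated : ∀ s K γ → 2 * γ ≡ 2 * s + K → γ ≤ K + 2 → 2 * K + 4 ≤ 3 * s →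
  γ ≡ K + 2 × 2 * s ≡ K + 4
double-saturated s K γ doubled γ≤ large = γ≡ , +-cancelʳ-≡ K _ _ (begin-equality
    2 * s + K     ≡⟨ doubled ⟨
    2 * γ         ≡⟨ cong (2 *_) γ≡ ⟩
    2 * (K + 2)   ≡⟨ shuffle K ⟩
    K + 4 + K     ∎)
  where
  open ≤-Reasoning
  shuffle : ∀ K → 2 * (K + 2) ≡ K + 4 + K
  shuffle = solve-∀
  6γ-large : 6 * (K + 1) < 6 * γ
  6γ-large = begin-strict
    6 * (K + 1)              <⟨ m<m+n (6 * (K + 1)) (s≤s z≤n) ⟩
    6 * (K + 1) + (2 + K)    ≡⟨ regroup K ⟩
    2 * (2 * K + 4) + 3 * K  ≤⟨ +-monoˡ-≤ (3 * K) (*-monoʳ-≤ 2 large) ⟩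
    2 * (3 * s) + 3 * K      ≡⟨ regroup′ s K ⟩
    3 * (2 * s + K)          ≡⟨ cong (3 *_) doubled ⟨
    3 * (2 * γ)              ≡⟨ *-assoc 3 2 γ ⟨
    6 * γ                    ∎
    where
    regroup : ∀ K → 6 * (K + 1) + (2 + K) ≡ 2 * (2 * K + 4) + 3 * K
    regroup = solve-∀
    regroup′ : ∀ s K → 2 * (3 * s) + 3 * K ≡ 3 * (2 * s + K)
    regroup′ = solve-∀
  γ≡ : γ ≡ K + 2
  γ≡ = ≤-antisym γ≤ (subst (_≤ γ) (sym (+-suc K 1)) (*-cancelˡ-< 6 (K + 1) γ 6γ-large))

large-pair-count : ∀ {n K p11 s} → n ≡ K + 4 → 2 * n ≤ p11 + 7 → p11 + 3 ≡ 3 * s → 2 * K + 4 ≤ 3 * s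
large-pair-count {n} {K} {p11} {s} n≡ 2n≤ p11+3≡ = +-cancelʳ-≤ 4 _ _ (begin
  2 * K + 4 + 4    ≡⟨ regroup K ⟩
  2 * (K + 4)      ≡⟨ cong (2 *_) n≡ ⟨
  2 * n            ≤⟨ 2n≤ ⟩
  p11 + 7          ≡⟨ +-assoc p11 3 4 ⟨
  p11 + 3 + 4      ≡⟨ cong (_+ 4) p11+3≡ ⟩
  3 * s + 4        ∎)
  where
  open ≤-Reasoning
  regroup : ∀ K → 2 * K + 4 + 4 ≡ 2 * (K + 4)
  regroup = solve-∀

-- Counts of the points d ∉ {a,b,c} by their pattern C_d: t for (1,1,1), z for (0,0,0), uᵢ for the
-- pattern whose only 1 is in position i, and wᵢ for its complement; s is the common pair count.
record Constraints (K s t z u₁ u₂ u₃ w₁ w₂ w₃ : ℕ) : Set where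
  field
    total : t + z + u₁ + u₂ + u₃ + w₁ + w₂ + w₃ ≡ suc K
    pair₁ : suc (t + u₁ + w₂ + w₃) ≡ s
    pair₂ : suc (t + u₂ + w₁ + w₃) ≡ s
    pair₃ : suc (t + u₃ + w₁ + w₂) ≡ s
    large : 2 * K + 4 ≤ 3 * s
    single₁ : 0 < u₁ → K ≤ s
    single₂ : 0 < u₂ → K ≤ s
    single₃ : 0 < u₃ → K ≤ s
    double₁ : 0 < w₁ → 2 * s ≡ K + 4
    double₂ : 0 < w₂ → 2 * s ≡ K + 4
    double₃ : 0 < w₃ → 2 * s ≡ K + 4
    clash₁ : s ≡ K → 0 < u₁ → 0 < w₁ → ⊥
    clash₂ : s ≡ K → 0 < u₂ → 0 < w₂ → ⊥
    clash₃ : s ≡ K → 0 < u₃ → 0 < w₃ → ⊥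

data Shape (u₁ u₂ u₃ w₁ w₂ w₃ : ℕ) : Set where
  all-constant   : u₁ ≡ 0 → u₂ ≡ 0 → u₃ ≡ 0 → w₁ ≡ 0 → w₂ ≡ 0 → w₃ ≡ 0 →
                   Shape u₁ u₂ u₃ w₁ w₂ w₃
  complementary₁ : u₁ ≡ 1 → u₂ ≡ 0 → u₃ ≡ 0 → w₁ ≡ 1 → w₂ ≡ 0 → w₃ ≡ 0 →
                   Shape u₁ u₂ u₃ w₁ w₂ w₃
  complementary₂ : u₁ ≡ 0 → u₂ ≡ 1 → u₃ ≡ 0 → w₁ ≡ 0 → w₂ ≡ 1 → w₃ ≡ 0 →
                   Shape u₁ u₂ u₃ w₁ w₂ w₃
  complementary₃ : u₁ ≡ 0 → u₂ ≡ 0 → u₃ ≡ 1 → w₁ ≡ 0 → w₂ ≡ 0 → w₃ ≡ 1 →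
                   Shape u₁ u₂ u₃ w₁ w₂ w₃
  three-singles  : u₁ ≡ 1 → u₂ ≡ 1 → u₃ ≡ 1 → w₁ ≡ 0 → w₂ ≡ 0 → w₃ ≡ 0 →
                   Shape u₁ u₂ u₃ w₁ w₂ w₃
  three-doubles  : u₁ ≡ 0 → u₂ ≡ 0 → u₃ ≡ 0 → w₁ ≡ 1 → w₂ ≡ 1 → w₃ ≡ 1 →
                   Shape u₁ u₂ u₃ w₁ w₂ w₃

singles-equal : ∀ {t a b s} → suc (t + a + 0 + 0) ≡ s → suc (t + b + 0 + 0) ≡ s → a ≡ b
singles-equal {t} {a} {b} pa pb = +-cancelˡ-≡ t a b (begin
  t + a          ≡⟨ +-identityʳ (t + a) ⟨
  t + a + 0      ≡⟨ +-identityʳ (t + a + 0) ⟨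
  t + a + 0 + 0  ≡⟨ suc-injective (trans pa (sym pb)) ⟩
  t + b + 0 + 0  ≡⟨ +-identityʳ (t + b + 0) ⟩
  t + b + 0      ≡⟨ +-identityʳ (t + b) ⟩
  t + b          ∎)
  where open ≡-Reasoning

no-doubles : ∀ {K s t z u₁ u₂ u₃} → Constraints K s t z u₁ u₂ u₃ 0 0 0 → Shape u₁ u₂ u₃ 0 0 0
no-doubles {u₁ = zero} c =
  all-constant refl (sym (singles-equal pair₁ pair₂)) (sym (singles-equal pair₁ pair₃)) refl refl refl
  where open Constraints c
no-doubles {K} {s} {t} {z} {suc m} {u₂} {u₃} c =
  three-singles (cong suc m≡0) (trans (sym u₂≡) (cong suc m≡0)) (trans (sym u₃≡) (cong suc m≡0)) refl refl refl
  where
  open Constraints c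
  u₂≡ : suc m ≡ u₂
  u₂≡ = singles-equal pair₁ pair₂
  u₃≡ : suc m ≡ u₃
  u₃≡ = singles-equal pair₁ pair₃
  u = suc m
  regroup : ∀ t z u → t + z + u + u + u + 0 + 0 + 0 ≡ (t + u) + (u + u) + z
  regroup = solve-∀
  regroup′ : ∀ t u → suc (suc (t + u + 0 + 0)) ≡ (t + u) + 2
  regroup′ = solve-∀
  2u≤2 : u + u ≤ 2
  2u≤2 = +-cancelˡ-≤ (t + u) (u + u) 2 (begin
    (t + u) + (u + u)                    ≤⟨ m≤m+n ((t + u) + (u + u)) z ⟩
    (t + u) + (u + u) + z                ≡⟨ regroup t z u ⟨
    t + z + u + u + u + 0 + 0 + 0        ≡⟨ cong₂ (λ x y → t + z + u + x + y + 0 + 0 + 0) u₂≡ u₃≡ ⟩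
    t + z + u + u₂ + u₃ + 0 + 0 + 0      ≡⟨ total ⟩
    suc K                                ≤⟨ s≤s (single₁ (s≤s z≤n)) ⟩
    suc s                                ≡⟨ cong suc pair₁ ⟨
    suc (suc (t + u + 0 + 0))            ≡⟨ regroup′ t u ⟩
    (t + u) + 2                          ∎)
    where open ≤-Reasoning
  m≡0 : m ≡ 0
  m≡0 = m+n≡0⇒m≡0 m (n≤0⇒n≡0 (+-cancelˡ-≤ 2 (m + m) 0 (subst (_≤ 2) (regroup″ m) 2u≤2)))
    where
    regroup″ : ∀ m → suc m + suc m ≡ 2 + (m + m)
    regroup″ = solve-∀

allUpTo : ℕ → (ℕ → Bool) → Bool
allUpTo zero f = f zero
allUpTo (suc b) f = f (suc b) ∧ allUpTo b f

allUpTo-sound : ∀ b f {x} → T (allUpTo b f) → x ≤ b → T (f x)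
allUpTo-sound zero f all z≤n = all
allUpTo-sound (suc b) f {x} all x≤ with m≤n⇒m<n∨m≡n x≤
... | inj₂ refl = Equivalence.to T-∧ all .proj₁
... | inj₁ (s≤s x≤b) = allUpTo-sound b f (Equivalence.to T-∧ all .proj₂) x≤b

allBounded : ∀ k → ℕ → (Vec ℕ k → Bool) → Bool
allBounded zero b P = P []
allBounded (suc k) b P = allUpTo b (λ x → allBounded k (b ∸ x) (P ∘ (x ∷_)))

allBounded-sound : ∀ k b P → T (allBounded k b P) → ∀ v → Vec.sum v ≤ b → T (P v)
allBounded-sound zero b P all [] _ = all
allBounded-sound (suc k) b P all (x ∷ v) x+v≤b =
  allBounded-sound k (b ∸ x) (P ∘ (x ∷_)) (allUpTo-sound b _ all (m+n≤o⇒m≤o x x+v≤b)) v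
    (subst (_≤ b ∸ x) (m+n∸m≡n x (Vec.sum v)) (∸-monoˡ-≤ x x+v≤b))

-- Once some wᵢ > 0 we have K ≤ 4, so the eight counts sum to at most 5; the constraints that are
-- still needed then are decided for every such count vector by evaluation.
SmallCase : (K s t z u₁ u₂ u₃ w₁ w₂ w₃ : ℕ) → Set
SmallCase K s t z u₁ u₂ u₃ w₁ w₂ w₃ =
  (suc (t + u₂ + w₁ + w₃) ≡ s) × (suc (t + u₃ + w₁ + w₂) ≡ s) × (2 * s ≡ K + 4) × (2 * K + 4 ≤ 3 * s) ×
  (s ≡ K → u₁ ≡ 0 ⊎ w₁ ≡ 0) × (s ≡ K → u₂ ≡ 0 ⊎ w₂ ≡ 0) × (s ≡ K → u₃ ≡ 0 ⊎ w₃ ≡ 0)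

smallCase? : ∀ K s t z u₁ u₂ u₃ w₁ w₂ w₃ → Dec (SmallCase K s t z u₁ u₂ u₃ w₁ w₂ w₃)
smallCase? K s t z u₁ u₂ u₃ w₁ w₂ w₃ =
  (suc (t + u₂ + w₁ + w₃) ≟ s) ×-dec (suc (t + u₃ + w₁ + w₂) ≟ s) ×-dec
  (2 * s ≟ K + 4) ×-dec (2 * K + 4 ≤? 3 * s) ×-dec
  ((s ≟ K) →-dec ((u₁ ≟ 0) ⊎-dec (w₁ ≟ 0))) ×-dec ((s ≟ K) →-dec ((u₂ ≟ 0) ⊎-dec (w₂ ≟ 0))) ×-dec
  ((s ≟ K) →-dec ((u₃ ≟ 0) ⊎-dec (w₃ ≟ 0)))

shape? : ∀ u₁ u₂ u₃ w₁ w₂ w₃ → Maybe (Shape u₁ u₂ u₃ w₁ w₂ w₃)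
shape? 0 0 0 0 0 0 = just (all-constant refl refl refl refl refl refl)
shape? 1 0 0 1 0 0 = just (complementary₁ refl refl refl refl refl refl)
shape? 0 1 0 0 1 0 = just (complementary₂ refl refl refl refl refl refl)
shape? 0 0 1 0 0 1 = just (complementary₃ refl refl refl refl refl refl)
shape? 1 1 1 0 0 0 = just (three-singles refl refl refl refl refl refl)
shape? 0 0 0 1 1 1 = just (three-doubles refl refl refl refl refl refl)
shape? _ _ _ _ _ _ = nothing

classifiesᵇ : Vec ℕ 8 → Bool
classifiesᵇ (t ∷ z ∷ u₁ ∷ u₂ ∷ u₃ ∷ w₁ ∷ w₂ ∷ w₃ ∷ []) =
  not (does (smallCase? K s t z u₁ u₂ u₃ w₁ w₂ w₃)) ∨ is-just (shape? u₁ u₂ u₃ w₁ w₂ w₃)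
  where
  K = pred (t + z + u₁ + u₂ + u₃ + w₁ + w₂ + w₃)
  s = suc (t + u₁ + w₂ + w₃)

small-counts-classified : T (allBounded 8 5 classifiesᵇ)
small-counts-classified = tt

with-double : ∀ {K s t z u₁ u₂ u₃ w₁ w₂ w₃} → Constraints K s t z u₁ u₂ u₃ w₁ w₂ w₃ → 2 * s ≡ K + 4 →
  Shape u₁ u₂ u₃ w₁ w₂ w₃
with-double {K} {s} {t} {z} {u₁} {u₂} {u₃} {w₁} {w₂} {w₃} c doubled =
  to-witness-T (shape? u₁ u₂ u₃ w₁ w₂ w₃)
    (modus-ponens {does decided} (allBounded-sound 8 5 classifiesᵇ small-counts-classified counts bounded)
                  (dec-true decided small))
  where
  open Constraints c
  counts : Vec ℕ 8
  counts = t ∷ z ∷ u₁ ∷ u₂ ∷ u₃ ∷ w₁ ∷ w₂ ∷ w₃ ∷ []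

  K≤4 : K ≤ 4
  K≤4 = +-cancelʳ-≤ 8 K 4 (+-cancelˡ-≤ (3 * K) (K + 8) (4 + 8) (begin
    3 * K + (K + 8)   ≡⟨ regroup K ⟩
    2 * (2 * K + 4)   ≤⟨ *-monoʳ-≤ 2 large ⟩
    2 * (3 * s)       ≡⟨ regroup′ s ⟩
    3 * (2 * s)       ≡⟨ cong (3 *_) doubled ⟩
    3 * (K + 4)       ≡⟨ regroup″ K ⟩
    3 * K + (4 + 8)   ∎))
    where
    open ≤-Reasoning
    regroup : ∀ K → 3 * K + (K + 8) ≡ 2 * (2 * K + 4)
    regroup = solve-∀
    regroup′ : ∀ s → 2 * (3 * s) ≡ 3 * (2 * s)
    regroup′ = solve-∀
    regroup″ : ∀ K → 3 * (K + 4) ≡ 3 * K + (4 + 8)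
    regroup″ = solve-∀

  bounded : Vec.sum counts ≤ 5
  bounded = subst (_≤ 5) (trans (sym total) (reassociate t z u₁ u₂ u₃ w₁ w₂ w₃)) (s≤s K≤4)
    where
    reassociate : ∀ t z u₁ u₂ u₃ w₁ w₂ w₃ → t + z + u₁ + u₂ + u₃ + w₁ + w₂ + w₃ ≡
                    t + (z + (u₁ + (u₂ + (u₃ + (w₁ + (w₂ + (w₃ + 0)))))))
    reassociate = solve-∀

  neither : ∀ {u w} → (0 < u → 0 < w → ⊥) → u ≡ 0 ⊎ w ≡ 0
  neither {zero} _ = inj₁ refl
  neither {suc _} {zero} _ = inj₂ refl
  neither {suc _} {suc _} both = contradiction (s≤s z≤n) (both (s≤s z≤n))

  K′ s′ : ℕ
  K′ = pred (t + z + u₁ + u₂ + u₃ + w₁ + w₂ + w₃)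
  s′ = suc (t + u₁ + w₂ + w₃)

  decided : Dec (SmallCase K′ s′ t z u₁ u₂ u₃ w₁ w₂ w₃)
  decided = smallCase? K′ s′ t z u₁ u₂ u₃ w₁ w₂ w₃

  small : SmallCase K′ s′ t z u₁ u₂ u₃ w₁ w₂ w₃
  small = subst₂ (λ K″ s″ → SmallCase K″ s″ t z u₁ u₂ u₃ w₁ w₂ w₃) (cong pred (sym total)) (sym pair₁)
    (pair₂ , pair₃ , doubled , large ,
     (λ e → neither (clash₁ e)) , (λ e → neither (clash₂ e)) , (λ e → neither (clash₃ e)))

  modus-ponens : ∀ {a b} → T (not a ∨ b) → a ≡ true → T b
  modus-ponens b refl = b

classify : ∀ {K s t z u₁ u₂ u₃ w₁ w₂ w₃} → Constraints K s t z u₁ u₂ u₃ w₁ w₂ w₃ →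
  Shape u₁ u₂ u₃ w₁ w₂ w₃
classify {w₁ = suc _} c = with-double c (Constraints.double₁ c (s≤s z≤n))
classify {w₁ = zero} {suc _} c = with-double c (Constraints.double₂ c (s≤s z≤n))
classify {w₁ = zero} {zero} {suc _} c = with-double c (Constraints.double₃ c (s≤s z≤n))
classify {w₁ = zero} {zero} {zero} c = no-doubles c

open ≡-Reasoning

-- Iverson brackets, finite sums and counting

⟦_⟧ : Bool → ℕ
⟦ b ⟧ = if b then 1 else 0

⟦∧⟧ : ∀ a b → ⟦ a ∧ b ⟧ ≡ ⟦ a ⟧ * ⟦ b ⟧
⟦∧⟧ true b = sym (+-identityʳ ⟦ b ⟧)
⟦∧⟧ false b = refl

∧-≡-true : ∀ {a b} → a ∧ b ≡ true → a ≡ true × b ≡ true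
∧-≡-true {true} b≡true = refl , b≡true

_⇔ᵇ_ : Bool → Bool → Bool
true ⇔ᵇ b = b
false ⇔ᵇ b = not b

⇔ᵇ-refl : ∀ x → (x ⇔ᵇ x) ≡ true
⇔ᵇ-refl true = refl
⇔ᵇ-refl false = refl

⇔ᵇ⇒≡ : ∀ {x y} → (x ⇔ᵇ y) ≡ true → x ≡ y
⇔ᵇ⇒≡ {true} {true} _ = refl
⇔ᵇ⇒≡ {false} {false} _ = refl

⇔ᵇ-true : ∀ b → (b ⇔ᵇ true) ≡ b
⇔ᵇ-true true = refl
⇔ᵇ-true false = refl

⇔ᵇ-false : ∀ b → (b ⇔ᵇ false) ≡ not b
⇔ᵇ-false true = refl
⇔ᵇ-false false = refl

_==_ : ∀ {n} → Fin n → Fin n → Bool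
x == y = toℕ x ≡ᵇ toℕ y

==-refl : ∀ {n} (x : Fin n) → x == x ≡ true
==-refl zero = refl
==-refl (suc x) = ==-refl x

==-sym : ∀ {n} (x y : Fin n) → x == y ≡ y == x
==-sym zero zero = refl
==-sym zero (suc y) = refl
==-sym (suc x) zero = refl
==-sym (suc x) (suc y) = ==-sym x y

==⇒≡ : ∀ {n} {x y : Fin n} → x == y ≡ true → x ≡ y
==⇒≡ {x = zero} {zero} _ = refl
==⇒≡ {x = suc x} {suc y} eq = cong suc (==⇒≡ eq)

≢⇒==false : ∀ {n} {x y : Fin n} → x ≢ y → x == y ≡ false
≢⇒==false {x = x} {y} x≢y with x == y in eq
... | true = contradiction (==⇒≡ eq) x≢y
... | false = refl

==false⇒≢ : ∀ {n} {x y : Fin n} → x == y ≡ false → x ≢ y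
==false⇒≢ {x = x} x==y refl = contradiction (trans (sym x==y) (==-refl x)) λ ()

sum-zero : ∀ n → ∑[ l < n ] 0 ≡ 0
sum-zero zero = refl
sum-zero (suc n) = sum-zero n

sum-one : ∀ n → ∑[ l < n ] 1 ≡ n
sum-one zero = refl
sum-one (suc n) = cong suc (sum-one n)

sum-mono-≤ : ∀ {n} {f g : Fin n → ℕ} → (∀ x → f x ≤ g x) → sum f ≤ sum g
sum-mono-≤ {zero} f≤g = z≤n
sum-mono-≤ {suc n} f≤g = +-mono-≤ (f≤g zero) (sum-mono-≤ (f≤g ∘ suc))

sum-mask-cong : ∀ {n} (m : Fin n → Bool) {f g : Fin n → ℕ} → (∀ l → m l ≡ true → f l ≡ g l) →
  ∑[ l < n ] (⟦ m l ⟧ * f l) ≡ ∑[ l < n ] (⟦ m l ⟧ * g l)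
sum-mask-cong m {f} {g} f≗g = sum-cong-≗ masked
  where
  masked : ∀ l → ⟦ m l ⟧ * f l ≡ ⟦ m l ⟧ * g l
  masked l with m l in ml
  ... | true = cong (_+ 0) (f≗g l ml)
  ... | false = refl

sum-extract : ∀ {n} (k : Fin n) (f : Fin n → ℕ) →
  sum f ≡ f k + ∑[ l < n ] (if l == k then 0 else f l)
sum-extract zero f = refl
sum-extract (suc k) f = begin
  f zero + sum (f ∘ suc)
    ≡⟨ cong (f zero +_) (sum-extract k (f ∘ suc)) ⟩
  f zero + (f (suc k) + _)
    ≡⟨ x∙yz≈y∙xz (f zero) (f (suc k)) _ ⟩
  f (suc k) + (f zero + _) ∎

outside₂ : ∀ {n} → Fin n → Fin n → Fin n → Bool
outside₂ i j l = not (l == i) ∧ not (l == j)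

outside₃ : ∀ {n} → Fin n → Fin n → Fin n → Fin n → Bool
outside₃ i j k l = not (l == i) ∧ not (l == j) ∧ not (l == k)

sum-split₂ : ∀ {n} {i j : Fin n} → i ≢ j → (f : Fin n → ℕ) →
  sum f ≡ f i + f j + ∑[ l < n ] (⟦ outside₂ i j l ⟧ * f l)
sum-split₂ {n} {i} {j} i≢j f = begin
  sum f
    ≡⟨ sum-extract i f ⟩
  f i + ∑[ l < n ] (if l == i then 0 else f l)
    ≡⟨ cong (f i +_) (sum-extract j (λ l → if l == i then 0 else f l)) ⟩
  f i + ((if j == i then 0 else f j) + ∑[ l < n ] (if l == j then 0 else if l == i then 0 else f l))
    ≡⟨ cong (λ b → f i + ((if b then 0 else f j) + rest)) (≢⇒==false (i≢j ∘ sym)) ⟩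
  f i + (f j + ∑[ l < n ] (if l == j then 0 else if l == i then 0 else f l))
    ≡⟨ cong (λ s → f i + (f j + s)) (sum-cong-≗ λ l → masked (l == i) (l == j) (f l)) ⟩
  f i + (f j + ∑[ l < n ] (⟦ outside₂ i j l ⟧ * f l))
    ≡⟨ +-assoc (f i) (f j) _ ⟨
  f i + f j + ∑[ l < n ] (⟦ outside₂ i j l ⟧ * f l) ∎
  where
  rest = ∑[ l < n ] (if l == j then 0 else if l == i then 0 else f l)
  masked : ∀ a b z → (if b then 0 else if a then 0 else z) ≡ ⟦ not a ∧ not b ⟧ * z
  masked false false z = sym (+-identityʳ z)
  masked false true z = refl
  masked true false z = refl
  masked true true z = refl

sum-split₃ : ∀ {n} {i j k : Fin n} → i ≢ j → i ≢ k → j ≢ k → (f : Fin n → ℕ) →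
  sum f ≡ f i + f j + f k + ∑[ l < n ] (⟦ outside₃ i j k l ⟧ * f l)
sum-split₃ {n} {i} {j} {k} i≢j i≢k j≢k f = begin
  sum f
    ≡⟨ sum-split₂ i≢j f ⟩
  f i + f j + ∑[ l < n ] (⟦ outside₂ i j l ⟧ * f l)
    ≡⟨ cong (f i + f j +_) (sum-extract k (λ l → ⟦ outside₂ i j l ⟧ * f l)) ⟩
  f i + f j + (⟦ outside₂ i j k ⟧ * f k + ∑[ l < n ] (if l == k then 0 else ⟦ outside₂ i j l ⟧ * f l))
    ≡⟨ cong (λ s → f i + f j + s) (cong₂ _+_ k-term (sum-cong-≗ λ l → masked (l == i) (l == j) (l == k) (f l))) ⟩
  f i + f j + (f k + ∑[ l < n ] (⟦ outside₃ i j k l ⟧ * f l))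
    ≡⟨ +-assoc (f i + f j) (f k) _ ⟨
  f i + f j + f k + ∑[ l < n ] (⟦ outside₃ i j k l ⟧ * f l) ∎
  where
  k-term : ⟦ outside₂ i j k ⟧ * f k ≡ f k
  k-term rewrite ≢⇒==false (i≢k ∘ sym) | ≢⇒==false (j≢k ∘ sym) = +-identityʳ (f k)
  masked : ∀ a b c z → (if c then 0 else ⟦ not a ∧ not b ⟧ * z) ≡ ⟦ not a ∧ not b ∧ not c ⟧ * z
  masked false false false z = refl
  masked false false true z = refl
  masked false true false z = refl
  masked false true true z = refl
  masked true b false z = refl
  masked true b true z = refl

count : ∀ {n} → (Fin n → Bool) → ℕ
count {n} q = ∑[ l < n ] ⟦ q l ⟧

countB-tabulate : ∀ {A : Set} n (p : A → Bool) (f : Fin n → A) →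
  countB p (tabulate f) ≡ ∑[ x < n ] ⟦ p (f x) ⟧
countB-tabulate zero p f = refl
countB-tabulate (suc n) p f = cong (⟦ p (f zero) ⟧ +_) (countB-tabulate n p (f ∘ suc))

countB-allFin : ∀ n (p : Fin n → Bool) → countB p (allFin n) ≡ ∑[ x < n ] ⟦ p x ⟧
countB-allFin n p = countB-tabulate n p (λ x → x)

count-zero⇒ : ∀ {n} (q : Fin n → Bool) → count q ≡ 0 → ∀ l → q l ≡ false
count-zero⇒ q eq zero with q zero
... | false = refl
count-zero⇒ q eq (suc l) = count-zero⇒ (q ∘ suc) (m+n≡0⇒n≡0 ⟦ q zero ⟧ eq) l

count-pos⇒ : ∀ {n} (q : Fin n → Bool) → 0 < count q → ∃ λ l → q l ≡ true
count-pos⇒ {suc n} q pos with q zero in eq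
... | true = zero , eq
... | false = let l , ql = count-pos⇒ (q ∘ suc) pos in suc l , ql

count-one⇒ : ∀ {n} (q : Fin n → Bool) → count q ≡ 1 →
  ∀ {l l′} → q l ≡ true → q l′ ≡ true → l ≡ l′
count-one⇒ q eq {zero} {zero} _ _ = refl
count-one⇒ q eq {zero} {suc l′} q0 ql′ rewrite q0 =
  contradiction (trans (sym ql′) (count-zero⇒ (q ∘ suc) (suc-injective eq) l′)) λ ()
count-one⇒ q eq {suc l} {zero} ql q0 rewrite q0 =
  contradiction (trans (sym ql) (count-zero⇒ (q ∘ suc) (suc-injective eq) l)) λ ()
count-one⇒ q eq {suc l} {suc l′} ql ql′ with q zero in q0
... | true = contradiction (trans (sym ql) (count-zero⇒ (q ∘ suc) (suc-injective eq) l)) λ ()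
... | false = cong suc (count-one⇒ (q ∘ suc) eq ql ql′)

count-∧-≤ : ∀ {n} (m p : Fin n → Bool) → count (λ l → m l ∧ p l) ≤ count m
count-∧-≤ m p = sum-mono-≤ λ l → ⟦∧⟧≤ (m l) (p l)
  where
  ⟦∧⟧≤ : ∀ a b → ⟦ a ∧ b ⟧ ≤ ⟦ a ⟧
  ⟦∧⟧≤ true true = ≤-refl
  ⟦∧⟧≤ true false = z≤n
  ⟦∧⟧≤ false b = z≤n

count-∧-full : ∀ {n} (m p : Fin n → Bool) → count (λ l → m l ∧ p l) ≡ count m →
  ∀ l → m l ≡ true → p l ≡ true
count-∧-full m p full l ml = not-injective (trans (cong (_∧ not (p l)) (sym ml)) (count-zero⇒ _ rest≡0 l))
  where
  split : ∀ a b → ⟦ a ⟧ ≡ ⟦ a ∧ b ⟧ + ⟦ a ∧ not b ⟧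
  split true true = refl
  split true false = refl
  split false b = refl
  rest≡0 : count (λ l → m l ∧ not (p l)) ≡ 0
  rest≡0 = +-cancelˡ-≡ (count (λ l → m l ∧ p l)) _ 0 (begin
    count (λ l → m l ∧ p l) + count (λ l → m l ∧ not (p l))
      ≡⟨ ∑-distrib-+ (λ l → ⟦ m l ∧ p l ⟧) (λ l → ⟦ m l ∧ not (p l) ⟧) ⟨
    ∑[ l < _ ] (⟦ m l ∧ p l ⟧ + ⟦ m l ∧ not (p l) ⟧)
      ≡⟨ sum-cong-≗ (λ l → split (m l) (p l)) ⟨
    count m ≡⟨ full ⟨
    count (λ l → m l ∧ p l) ≡⟨ +-identityʳ _ ⟨
    count (λ l → m l ∧ p l) + 0 ∎)

-- Sums over lists and over all subsets

sumOver : {A : Set} → List A → (A → ℕ) → ℕ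
sumOver [] f = 0
sumOver (x ∷ xs) f = f x + sumOver xs f

countB≡sumOver : ∀ {A : Set} (p : A → Bool) xs → countB p xs ≡ sumOver xs (⟦_⟧ ∘ p)
countB≡sumOver p [] = refl
countB≡sumOver p (x ∷ xs) = cong (⟦ p x ⟧ +_) (countB≡sumOver p xs)

module _ {A : Set} where

  sumOver-cong : ∀ xs {f g : A → ℕ} → (∀ x → f x ≡ g x) → sumOver xs f ≡ sumOver xs g
  sumOver-cong [] f≗g = refl
  sumOver-cong (x ∷ xs) f≗g = cong₂ _+_ (f≗g x) (sumOver-cong xs f≗g)

  sumOver-zero : ∀ xs → sumOver {A} xs (λ _ → 0) ≡ 0
  sumOver-zero [] = refl
  sumOver-zero (x ∷ xs) = sumOver-zero xs

  sumOver-++ : ∀ xs ys (f : A → ℕ) → sumOver (xs ++ ys) f ≡ sumOver xs f + sumOver ys f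
  sumOver-++ [] ys f = refl
  sumOver-++ (x ∷ xs) ys f = trans (cong (f x +_) (sumOver-++ xs ys f)) (sym (+-assoc (f x) _ _))

  sumOver-map : ∀ {B : Set} (h : B → A) xs (f : A → ℕ) → sumOver (map h xs) f ≡ sumOver xs (f ∘ h)
  sumOver-map h [] f = refl
  sumOver-map h (x ∷ xs) f = cong (f (h x) +_) (sumOver-map h xs f)

  sumOver-distrib-+ : ∀ xs (f g : A → ℕ) → sumOver xs (λ x → f x + g x) ≡ sumOver xs f + sumOver xs g
  sumOver-distrib-+ [] f g = refl
  sumOver-distrib-+ (x ∷ xs) f g = trans (cong (f x + g x +_) (sumOver-distrib-+ xs f g)) (interchange (f x) (g x) _ _)

  *-distribˡ-sumOver : ∀ c xs (f : A → ℕ) → c * sumOver xs f ≡ sumOver xs (λ x → c * f x)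
  *-distribˡ-sumOver c [] f = *-zeroʳ c
  *-distribˡ-sumOver c (x ∷ xs) f = trans (*-distribˡ-+ c (f x) _) (cong (c * f x +_) (*-distribˡ-sumOver c xs f))

  sumOver-comm-∑ : ∀ {n} xs (g : A → Fin n → ℕ) →
    sumOver xs (λ x → ∑[ l < n ] g x l) ≡ ∑[ l < n ] sumOver xs (λ x → g x l)
  sumOver-comm-∑ {n} [] g = sym (sum-zero n)
  sumOver-comm-∑ (x ∷ xs) g = trans (cong (sum (g x) +_) (sumOver-comm-∑ xs g)) (sym (∑-distrib-+ (g x) _))

every : ∀ {n} → (Fin n → Bool) → Bool
every {zero} h = true
every {suc n} h = h zero ∧ every (h ∘ suc)

every-cong : ∀ {n} {h h′ : Fin n → Bool} → (∀ x → h x ≡ h′ x) → every h ≡ every h′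
every-cong {zero} h≗h′ = refl
every-cong {suc n} h≗h′ = cong₂ _∧_ (h≗h′ zero) (every-cong (h≗h′ ∘ suc))

every-extract : ∀ {n} (k : Fin n) (h : Fin n → Bool) → every h ≡ (h k ∧ every (λ x → x == k ∨ h x))
every-extract zero h = refl
every-extract (suc k) h = trans (cong (h zero ∧_) (every-extract k (h ∘ suc))) (∧-swap (h zero) (h (suc k)) _)
  where
  ∧-swap : ∀ a b c → (a ∧ (b ∧ c)) ≡ (b ∧ (a ∧ c))
  ∧-swap true b c = refl
  ∧-swap false true c = refl
  ∧-swap false false c = refl

_=ˢ_ : ∀ {n} → Subset n → Subset n → Bool
v =ˢ w = every (λ x → lookup v x ⇔ᵇ lookup w x)

sumOver-allSubsets-δ : ∀ {n} (w : Subset n) (g : Subset n → ℕ) →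
  sumOver (allSubsets n) (λ v → ⟦ v =ˢ w ⟧ * g v) ≡ g w
sumOver-allSubsets-δ [] g = trans (+-identityʳ _) (+-identityʳ (g []))
sumOver-allSubsets-δ {suc n} (b ∷ w) g = begin
  sumOver (map (inside ∷_) S ++ map (outside ∷_) S) f
    ≡⟨ sumOver-++ (map (inside ∷_) S) _ f ⟩
  sumOver (map (inside ∷_) S) f + sumOver (map (outside ∷_) S) f
    ≡⟨ cong₂ _+_ (sumOver-map (inside ∷_) S f) (sumOver-map (outside ∷_) S f) ⟩
  sumOver S (f ∘ (inside ∷_)) + sumOver S (f ∘ (outside ∷_))
    ≡⟨ split b ⟩
  g (b ∷ w) ∎
  where
  S = allSubsets n
  f = λ v → ⟦ v =ˢ (b ∷ w) ⟧ * g v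
  split : ∀ b → sumOver S (λ v → ⟦ (inside ∷ v) =ˢ (b ∷ w) ⟧ * g (inside ∷ v))
              + sumOver S (λ v → ⟦ (outside ∷ v) =ˢ (b ∷ w) ⟧ * g (outside ∷ v)) ≡ g (b ∷ w)
  split true = trans (cong₂ _+_ (sumOver-allSubsets-δ w (g ∘ (inside ∷_))) (sumOver-zero S)) (+-identityʳ _)
  split false = trans (cong (_+ sumOver S (λ v → ⟦ v =ˢ w ⟧ * g (outside ∷ v))) (sumOver-zero S))
    (sumOver-allSubsets-δ w (g ∘ (outside ∷_)))

-- Subsets of Fin n and neighbourhoods in J(n,3)

lookup-⁅⁆ : ∀ {n} (i x : Fin n) → lookup ⁅ i ⁆ x ≡ x == i
lookup-⁅⁆ zero zero = refl
lookup-⁅⁆ zero (suc x) = lookup-replicate x false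
lookup-⁅⁆ (suc i) zero = refl
lookup-⁅⁆ (suc i) (suc x) = lookup-⁅⁆ i x

lookup-triple : ∀ {n} (i j k x : Fin n) → lookup (triple i j k) x ≡ (x == i ∨ x == j ∨ x == k)
lookup-triple i j k x = begin
  lookup (⁅ i ⁆ ∪ ⁅ j ⁆ ∪ ⁅ k ⁆) x
    ≡⟨ lookup-zipWith _∨_ x ⁅ i ⁆ (⁅ j ⁆ ∪ ⁅ k ⁆) ⟩
  lookup ⁅ i ⁆ x ∨ lookup (⁅ j ⁆ ∪ ⁅ k ⁆) x
    ≡⟨ cong (lookup ⁅ i ⁆ x ∨_) (lookup-zipWith _∨_ x ⁅ j ⁆ ⁅ k ⁆) ⟩
  lookup ⁅ i ⁆ x ∨ lookup ⁅ j ⁆ x ∨ lookup ⁅ k ⁆ x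
    ≡⟨ cong₂ _∨_ (lookup-⁅⁆ i x) (cong₂ _∨_ (lookup-⁅⁆ j x) (lookup-⁅⁆ k x)) ⟩
  x == i ∨ x == j ∨ x == k ∎

∣∣≡count : ∀ {n} (v : Subset n) → ∣ v ∣ ≡ count (lookup v)
∣∣≡count [] = refl
∣∣≡count (true ∷ v) = cong suc (∣∣≡count v)
∣∣≡count (false ∷ v) = ∣∣≡count v

isSingletonOn : ∀ {n} → (Fin n → Bool) → (Fin n → Bool) → Fin n → Bool
isSingletonOn m w l = every (λ x → not (m x) ∨ (w x ⇔ᵇ (x == l)))

every-disjoint : ∀ {n} (m w : Fin n → Bool) →
  every (λ x → not (m x) ∨ (w x ⇔ᵇ false)) ≡ (count (λ x → m x ∧ w x) ≡ᵇ 0)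
every-disjoint {zero} m w = refl
every-disjoint {suc n} m w with m zero | w zero
... | true | true = refl
... | true | false = every-disjoint (m ∘ suc) (w ∘ suc)
... | false | _ = every-disjoint (m ∘ suc) (w ∘ suc)

count-isSingletonOn : ∀ {n} (m w : Fin n → Bool) →
  ∑[ l < n ] (⟦ m l ⟧ * ⟦ isSingletonOn m w l ⟧) ≡ ⟦ count (λ x → m x ∧ w x) ≡ᵇ 1 ⟧
count-isSingletonOn {zero} m w = refl
count-isSingletonOn {suc n} m w with m zero | w zero
... | true | true = begin
  ⟦ E ⟧ + 0 + ∑[ l < n ] (⟦ m (suc l) ⟧ * 0)
    ≡⟨ cong₂ _+_ (+-identityʳ ⟦ E ⟧) (trans (sum-cong-≗ λ l → *-zeroʳ ⟦ m (suc l) ⟧) (sum-zero n)) ⟩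
  ⟦ E ⟧ + 0
    ≡⟨ +-identityʳ ⟦ E ⟧ ⟩
  ⟦ E ⟧
    ≡⟨ cong ⟦_⟧ (every-disjoint (m ∘ suc) (w ∘ suc)) ⟩
  ⟦ count (λ x → m (suc x) ∧ w (suc x)) ≡ᵇ 0 ⟧ ∎
  where
  E = every (λ x → not (m (suc x)) ∨ (w (suc x) ⇔ᵇ false))
... | true | false = count-isSingletonOn (m ∘ suc) (w ∘ suc)
... | false | _ = count-isSingletonOn (m ∘ suc) (w ∘ suc)

⟦∧₄⟧ : ∀ a b c d → ⟦ a ∧ b ∧ c ∧ d ⟧ ≡ ⟦ a ∧ b ∧ c ⟧ * ⟦ d ⟧
⟦∧₄⟧ true true true d = sym (*-identityˡ ⟦ d ⟧)
⟦∧₄⟧ true true false d = refl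
⟦∧₄⟧ true false c d = refl
⟦∧₄⟧ false b c d = refl

exactly-two : ∀ a b c →
  ⟦ ⟦ a ⟧ + ⟦ b ⟧ + ⟦ c ⟧ ≡ᵇ 2 ⟧ ≡ ⟦ a ∧ b ∧ not c ⟧ + ⟦ a ∧ not b ∧ c ⟧ + ⟦ not a ∧ b ∧ c ⟧
exactly-two true true true = refl
exactly-two true true false = refl
exactly-two true false true = refl
exactly-two true false false = refl
exactly-two false true true = refl
exactly-two false true false = refl
exactly-two false false true = refl
exactly-two false false false = refl

⟦+≡ᵇ3∧≡ᵇ2⟧ : ∀ a r → ⟦ (a + r ≡ᵇ 3) ∧ (a ≡ᵇ 2) ⟧ ≡ ⟦ a ≡ᵇ 2 ⟧ * ⟦ r ≡ᵇ 1 ⟧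
⟦+≡ᵇ3∧≡ᵇ2⟧ 0 r = cong ⟦_⟧ (∧-zeroʳ (r ≡ᵇ 3))
⟦+≡ᵇ3∧≡ᵇ2⟧ 1 r = cong ⟦_⟧ (∧-zeroʳ (suc r ≡ᵇ 3))
⟦+≡ᵇ3∧≡ᵇ2⟧ 2 r = trans (cong ⟦_⟧ (∧-identityʳ (r ≡ᵇ 1))) (sym (*-identityˡ ⟦ r ≡ᵇ 1 ⟧))
⟦+≡ᵇ3∧≡ᵇ2⟧ (suc (suc (suc a))) r = cong ⟦_⟧ (∧-zeroʳ (a + r ≡ᵇ 0))

⟦∧∧xor⟧ : ∀ a b c → ⟦ a ∧ b ∧ not (c xor true) ⟧ ≡ ⟦ a ∧ b ⟧ * ⟦ c ⟧
⟦∧∧xor⟧ true true true = refl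
⟦∧∧xor⟧ true true false = refl
⟦∧∧xor⟧ true false c = refl
⟦∧∧xor⟧ false b c = refl

triple-swap₂₃ : ∀ {n} (x y z : Fin n) → triple x y z ≡ triple x z y
triple-swap₂₃ x y z = cong (⁅ x ⁆ ∪_) (∪-comm ⁅ y ⁆ ⁅ z ⁆)

triple-swap₁₂ : ∀ {n} (x y z : Fin n) → triple x y z ≡ triple y x z
triple-swap₁₂ x y z = begin
  ⁅ x ⁆ ∪ ⁅ y ⁆ ∪ ⁅ z ⁆   ≡⟨ ∪-assoc ⁅ x ⁆ ⁅ y ⁆ ⁅ z ⁆ ⟨
  (⁅ x ⁆ ∪ ⁅ y ⁆) ∪ ⁅ z ⁆ ≡⟨ cong (_∪ ⁅ z ⁆) (∪-comm ⁅ x ⁆ ⁅ y ⁆) ⟩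
  (⁅ y ⁆ ∪ ⁅ x ⁆) ∪ ⁅ z ⁆ ≡⟨ ∪-assoc ⁅ y ⁆ ⁅ x ⁆ ⁅ z ⁆ ⟩
  ⁅ y ⁆ ∪ ⁅ x ⁆ ∪ ⁅ z ⁆   ∎

pairCount≡count : ∀ {n} (χ : Subset n → Bool) (x y : Fin n) →
  pairCount χ x y ≡ count (λ l → outside₂ x y l ∧ χ (triple x y l))
pairCount≡count {n} χ x y = trans (countB-allFin n _)
  (sum-cong-≗ λ l → cong ⟦_⟧ (sym (∧-assoc (not (l == x)) (not (l == y)) (χ (triple x y l)))))

count-outside₂ : ∀ {n} {x y : Fin n} → x ≢ y → count (outside₂ x y) + 2 ≡ n
count-outside₂ {n} {x} {y} x≢y = begin
  count (outside₂ x y) + 2                  ≡⟨ +-comm (count (outside₂ x y)) 2 ⟩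
  2 + count (outside₂ x y)                  ≡⟨ cong (2 +_) (sum-cong-≗ λ l → sym (*-identityʳ ⟦ outside₂ x y l ⟧)) ⟩
  1 + 1 + ∑[ l < n ] (⟦ outside₂ x y l ⟧ * 1) ≡⟨ sum-split₂ x≢y (λ _ → 1) ⟨
  ∑[ l < n ] 1                              ≡⟨ sum-one n ⟩
  n ∎

pairCount-≤ : ∀ {n} (χ : Subset n → Bool) {x y : Fin n} → x ≢ y → pairCount χ x y + 2 ≤ n
pairCount-≤ χ {x} {y} x≢y = ≤-trans (≤-reflexive (cong (_+ 2) (pairCount≡count χ x y)))
  (≤-trans (+-monoˡ-≤ 2 (count-∧-≤ (outside₂ x y) (λ l → χ (triple x y l)))) (≤-reflexive (count-outside₂ x≢y)))

pairCount-full : ∀ {n} (χ : Subset n → Bool) {x y : Fin n} → x ≢ y → pairCount χ x y + 2 ≡ n →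
  ∀ l → l ≢ x → l ≢ y → χ (triple x y l) ≡ true
pairCount-full χ {x} {y} x≢y full l l≢x l≢y =
  count-∧-full (outside₂ x y) (λ l → χ (triple x y l))
    (+-cancelʳ-≡ 2 _ _ (trans (sym (cong (_+ 2) (pairCount≡count χ x y))) (trans full (sym (count-outside₂ x≢y)))))
    l (cong₂ (λ a b → not a ∧ not b) (≢⇒==false l≢x) (≢⇒==false l≢y))

pairCount-zero : ∀ {n} (χ : Subset n → Bool) {x y : Fin n} → pairCount χ x y ≡ 0 →
  ∀ l → l ≢ x → l ≢ y → χ (triple x y l) ≡ false
pairCount-zero χ {x} {y} empty l l≢x l≢y =
  subst (λ m → m ∧ χ (triple x y l) ≡ false)
    (cong₂ (λ a b → not a ∧ not b) (≢⇒==false l≢x) (≢⇒==false l≢y))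
    (count-zero⇒ _ (trans (sym (pairCount≡count χ x y)) empty) l)

∨₃ : ∀ {a b c a′ b′ c′} → a ≡ a′ → b ≡ b′ → c ≡ c′ → (a ∨ b ∨ c) ≡ (a′ ∨ b′ ∨ c′)
∨₃ refl refl refl = refl

hit₁ : ∀ {a b} → a ≡ true → (a ∨ b) ≡ true
hit₁ refl = refl

hit₂ : ∀ {a b c} → a ≡ false → b ≡ true → (a ∨ b ∨ c) ≡ true
hit₂ refl refl = refl

module Triple {n} {i j k : Fin n} (i≢j : i ≢ j) (i≢k : i ≢ k) (j≢k : j ≢ k) where

  out : Fin n → Bool
  out = outside₃ i j k

  j==i : j == i ≡ false
  j==i = ≢⇒==false (i≢j ∘ sym)
  k==i : k == i ≡ false
  k==i = ≢⇒==false (i≢k ∘ sym)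
  k==j : k == j ≡ false
  k==j = ≢⇒==false (j≢k ∘ sym)
  i==j : i == j ≡ false
  i==j = ≢⇒==false i≢j
  i==k : i == k ≡ false
  i==k = ≢⇒==false i≢k
  j==k : j == k ≡ false
  j==k = ≢⇒==false j≢k

  record Outside (x : Fin n) : Set where
    field
      x==i : x == i ≡ false
      x==j : x == j ≡ false
      x==k : x == k ≡ false

  out⇒Outside : ∀ x → out x ≡ true → Outside x
  out⇒Outside x ox with x == i in xi | x == j in xj | x == k in xk
  ... | false | false | false = record { x==i = xi ; x==j = xj ; x==k = xk }

  every-split₃ : (h : Fin n → Bool) → every h ≡ (h i ∧ h j ∧ h k ∧ every (λ x → not (out x) ∨ h x))
  every-split₃ h = begin
    every h
      ≡⟨ every-extract i h ⟩
    h i ∧ every (λ x → x == i ∨ h x)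
      ≡⟨ cong (h i ∧_) (every-extract j (λ x → x == i ∨ h x)) ⟩
    h i ∧ (j == i ∨ h j) ∧ every (λ x → x == j ∨ x == i ∨ h x)
      ≡⟨ cong (λ b → h i ∧ (b ∨ h j) ∧ every (λ x → x == j ∨ x == i ∨ h x)) j==i ⟩
    h i ∧ h j ∧ every (λ x → x == j ∨ x == i ∨ h x)
      ≡⟨ cong (λ e → h i ∧ h j ∧ e) (every-extract k (λ x → x == j ∨ x == i ∨ h x)) ⟩
    h i ∧ h j ∧ (k == j ∨ k == i ∨ h k) ∧ every (λ x → x == k ∨ x == j ∨ x == i ∨ h x)
      ≡⟨ cong₂ (λ b c → h i ∧ h j ∧ (b ∨ c ∨ h k) ∧ every (λ x → x == k ∨ x == j ∨ x == i ∨ h x))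
               k==j k==i ⟩
    h i ∧ h j ∧ h k ∧ every (λ x → x == k ∨ x == j ∨ x == i ∨ h x)
      ≡⟨ cong (λ e → h i ∧ h j ∧ h k ∧ e) (every-cong λ x → masks (x == i) (x == j) (x == k) (h x)) ⟩
    h i ∧ h j ∧ h k ∧ every (λ x → not (out x) ∨ h x) ∎
    where
    masks : ∀ a b c d → (c ∨ b ∨ a ∨ d) ≡ (not (not a ∧ not b ∧ not c) ∨ d)
    masks false false false d = refl
    masks false false true d = refl
    masks false true false d = refl
    masks false true true d = refl
    masks true false false d = refl
    masks true false true d = refl
    masks true true false d = refl
    masks true true true d = refl

  module _ (v : Subset n) where

    private
      V : Fin n → Bool
      V = lookup v

    inside-count : ℕ
    inside-count = ⟦ V i ⟧ + ⟦ V j ⟧ + ⟦ V k ⟧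

    outside-count : ℕ
    outside-count = count (λ x → out x ∧ V x)

    card-split : ∣ v ∣ ≡ inside-count + outside-count
    card-split = begin
      ∣ v ∣                                          ≡⟨ ∣∣≡count v ⟩
      count V                                        ≡⟨ sum-split₃ i≢j i≢k j≢k (⟦_⟧ ∘ V) ⟩
      inside-count + ∑[ x < n ] (⟦ out x ⟧ * ⟦ V x ⟧)
        ≡⟨ cong (inside-count +_) (sum-cong-≗ λ x → sym (⟦∧⟧ (out x) (V x))) ⟩
      inside-count + outside-count                   ∎

    card-∩ : ∣ triple i j k ∩ v ∣ ≡ inside-count
    card-∩ = begin
      ∣ triple i j k ∩ v ∣
        ≡⟨ ∣∣≡count (triple i j k ∩ v) ⟩
      count (lookup (triple i j k ∩ v))
        ≡⟨ sum-cong-≗ (λ x → cong ⟦_⟧ (lookup-∩ x)) ⟩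
      sum g
        ≡⟨ sum-split₃ i≢j i≢k j≢k g ⟩
      g i + g j + g k + ∑[ x < n ] (⟦ out x ⟧ * g x)
        ≡⟨ cong₂ _+_ (cong₂ _+_ (cong₂ _+_ g-i g-j) g-k)
                     (trans (sum-mask-cong out g-out) (trans (sum-cong-≗ λ x → *-zeroʳ ⟦ out x ⟧) (sum-zero n))) ⟩
      inside-count + 0
        ≡⟨ +-identityʳ inside-count ⟩
      inside-count ∎
      where
      g : Fin n → ℕ
      g x = ⟦ (x == i ∨ x == j ∨ x == k) ∧ V x ⟧
      lookup-∩ : ∀ x → lookup (triple i j k ∩ v) x ≡ ((x == i ∨ x == j ∨ x == k) ∧ V x)
      lookup-∩ x = trans (lookup-zipWith _∧_ x (triple i j k) v) (cong (_∧ V x) (lookup-triple i j k x))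
      g-i : g i ≡ ⟦ V i ⟧
      g-i rewrite ==-refl i = refl
      g-j : g j ≡ ⟦ V j ⟧
      g-j rewrite j==i | ==-refl j = refl
      g-k : g k ≡ ⟦ V k ⟧
      g-k rewrite k==i | k==j | ==-refl k = refl
      g-out : ∀ x → out x ≡ true → g x ≡ 0
      g-out x ox = none (x==i) (x==j) (x==k)
        where
        open Outside (out⇒Outside x ox)
        none : ∀ {a b c} → a ≡ false → b ≡ false → c ≡ false → ⟦ (a ∨ b ∨ c) ∧ V x ⟧ ≡ 0
        none refl refl refl = refl

    private
      matches : Fin n → Fin n → Fin n → Fin n → Bool
      matches p q l x = V x ⇔ᵇ (x == p ∨ x == q ∨ x == l)

      =ˢ-triple : ∀ p q l → v =ˢ triple p q l ≡
        (matches p q l i ∧ matches p q l j ∧ matches p q l k ∧ every (λ x → not (out x) ∨ matches p q l x))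
      =ˢ-triple p q l =
        trans (every-cong λ x → cong (V x ⇔ᵇ_) (lookup-triple p q l x)) (every-split₃ (matches p q l))

      outside-matches : ∀ p q l → (∀ x → out x ≡ true → (x == p ≡ false) × (x == q ≡ false)) →
        every (λ x → not (out x) ∨ matches p q l x) ≡ isSingletonOn out V l
      outside-matches p q l pq = every-cong pointwise
        where
        pointwise : ∀ x → (not (out x) ∨ matches p q l x) ≡ (not (out x) ∨ (V x ⇔ᵇ (x == l)))
        pointwise x with out x in ox
        ... | false = refl
        ... | true = let x≠p , x≠q = pq x ox in cong (V x ⇔ᵇ_) (∨₃ x≠p x≠q refl)

      ⇔ᵇ-hit : ∀ x {p q l} → (x == p ∨ x == q ∨ x == l) ≡ true → matches p q l x ≡ V x
      ⇔ᵇ-hit x hit = trans (cong (V x ⇔ᵇ_) hit) (⇔ᵇ-true (V x))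

      ⇔ᵇ-miss : ∀ x {p q l} → (x == p ∨ x == q ∨ x == l) ≡ false → matches p q l x ≡ not (V x)
      ⇔ᵇ-miss x miss = trans (cong (V x ⇔ᵇ_) miss) (⇔ᵇ-false (V x))

    module _ (l : Fin n) (ol : out l ≡ true) where
      private
        open Outside (out⇒Outside l ol) renaming (x==i to l==i; x==j to l==j; x==k to l==k)
        i==l = trans (==-sym i l) l==i
        j==l = trans (==-sym j l) l==j
        k==l = trans (==-sym k l) l==k

      =ˢ-ijl : v =ˢ triple i j l ≡ (V i ∧ V j ∧ not (V k) ∧ isSingletonOn out V l)
      =ˢ-ijl = trans (=ˢ-triple i j l) (cong₂ _∧_ (⇔ᵇ-hit i (hit₁ (==-refl i)))
        (cong₂ _∧_ (⇔ᵇ-hit j (hit₂ j==i (==-refl j)))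
        (cong₂ _∧_ (⇔ᵇ-miss k (∨₃ k==i k==j k==l))
        (outside-matches i j l λ x ox → let open Outside (out⇒Outside x ox) in x==i , x==j))))

      =ˢ-ikl : v =ˢ triple i k l ≡ (V i ∧ not (V j) ∧ V k ∧ isSingletonOn out V l)
      =ˢ-ikl = trans (=ˢ-triple i k l) (cong₂ _∧_ (⇔ᵇ-hit i (hit₁ (==-refl i)))
        (cong₂ _∧_ (⇔ᵇ-miss j (∨₃ j==i j==k j==l))
        (cong₂ _∧_ (⇔ᵇ-hit k (hit₂ k==i (==-refl k)))
        (outside-matches i k l λ x ox → let open Outside (out⇒Outside x ox) in x==i , x==k))))

      =ˢ-jkl : v =ˢ triple j k l ≡ (not (V i) ∧ V j ∧ V k ∧ isSingletonOn out V l)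
      =ˢ-jkl = trans (=ˢ-triple j k l) (cong₂ _∧_ (⇔ᵇ-miss i (∨₃ i==j i==k i==l))
        (cong₂ _∧_ (⇔ᵇ-hit j (hit₁ (==-refl j)))
        (cong₂ _∧_ (⇔ᵇ-hit k (hit₂ k==j (==-refl k)))
        (outside-matches j k l λ x ox → let open Outside (out⇒Outside x ox) in x==j , x==k))))

    private
      P : ℕ
      P = ⟦ V i ∧ V j ∧ not (V k) ⟧ + ⟦ V i ∧ not (V j) ∧ V k ⟧ + ⟦ not (V i) ∧ V j ∧ V k ⟧

      neighbour-patterns : ∀ l → out l ≡ true →
        ⟦ v =ˢ triple i j l ⟧ + ⟦ v =ˢ triple i k l ⟧ + ⟦ v =ˢ triple j k l ⟧ ≡ P * ⟦ isSingletonOn out V l ⟧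
      neighbour-patterns l ol = begin
        ⟦ v =ˢ triple i j l ⟧ + ⟦ v =ˢ triple i k l ⟧ + ⟦ v =ˢ triple j k l ⟧
          ≡⟨ cong₂ _+_ (cong₂ _+_ (cong ⟦_⟧ (=ˢ-ijl l ol)) (cong ⟦_⟧ (=ˢ-ikl l ol))) (cong ⟦_⟧ (=ˢ-jkl l ol)) ⟩
        ⟦ V i ∧ V j ∧ not (V k) ∧ S ⟧ + ⟦ V i ∧ not (V j) ∧ V k ∧ S ⟧ + ⟦ not (V i) ∧ V j ∧ V k ∧ S ⟧
          ≡⟨ cong₂ _+_ (cong₂ _+_ (⟦∧₄⟧ (V i) (V j) (not (V k)) S) (⟦∧₄⟧ (V i) (not (V j)) (V k) S))
                       (⟦∧₄⟧ (not (V i)) (V j) (V k) S) ⟩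
        X * ⟦ S ⟧ + Y * ⟦ S ⟧ + Z * ⟦ S ⟧
          ≡⟨ cong (_+ Z * ⟦ S ⟧) (*-distribʳ-+ ⟦ S ⟧ X Y) ⟨
        (X + Y) * ⟦ S ⟧ + Z * ⟦ S ⟧
          ≡⟨ *-distribʳ-+ ⟦ S ⟧ (X + Y) Z ⟨
        P * ⟦ S ⟧ ∎
        where
        S = isSingletonOn out V l
        X = ⟦ V i ∧ V j ∧ not (V k) ⟧
        Y = ⟦ V i ∧ not (V j) ∧ V k ⟧
        Z = ⟦ not (V i) ∧ V j ∧ V k ⟧

    neighbour-indicator : ⟦ isVertex v ∧ adjacent (triple i j k) v ⟧ ≡
      ∑[ l < n ] (⟦ out l ⟧ * (⟦ v =ˢ triple i j l ⟧ + ⟦ v =ˢ triple i k l ⟧ + ⟦ v =ˢ triple j k l ⟧))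
    neighbour-indicator = begin
      ⟦ (∣ v ∣ ≡ᵇ 3) ∧ (∣ triple i j k ∩ v ∣ ≡ᵇ 2) ⟧
        ≡⟨ cong₂ (λ a b → ⟦ (a ≡ᵇ 3) ∧ (b ≡ᵇ 2) ⟧) card-split card-∩ ⟩
      ⟦ (inside-count + outside-count ≡ᵇ 3) ∧ (inside-count ≡ᵇ 2) ⟧
        ≡⟨ ⟦+≡ᵇ3∧≡ᵇ2⟧ inside-count outside-count ⟩
      ⟦ inside-count ≡ᵇ 2 ⟧ * ⟦ outside-count ≡ᵇ 1 ⟧
        ≡⟨ cong₂ _*_ (exactly-two (V i) (V j) (V k)) (sym (count-isSingletonOn out V)) ⟩
      P * ∑[ l < n ] (⟦ out l ⟧ * ⟦ isSingletonOn out V l ⟧)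
        ≡⟨ *-distribˡ-sum P (λ l → ⟦ out l ⟧ * ⟦ isSingletonOn out V l ⟧) ⟩
      ∑[ l < n ] (P * (⟦ out l ⟧ * ⟦ isSingletonOn out V l ⟧))
        ≡⟨ sum-cong-≗ (λ l → *-swap P ⟦ out l ⟧ ⟦ isSingletonOn out V l ⟧) ⟩
      ∑[ l < n ] (⟦ out l ⟧ * (P * ⟦ isSingletonOn out V l ⟧))
        ≡⟨ sum-mask-cong out (λ l ol → sym (neighbour-patterns l ol)) ⟩
      ∑[ l < n ] (⟦ out l ⟧ * (⟦ v =ˢ triple i j l ⟧ + ⟦ v =ˢ triple i k l ⟧ + ⟦ v =ˢ triple j k l ⟧)) ∎

  nbrsIn-triple : ∀ χ → nbrsIn χ true (triple i j k) ≡
    ∑[ l < n ] (⟦ out l ⟧ * (⟦ χ (triple i j l) ⟧ + ⟦ χ (triple i k l) ⟧ + ⟦ χ (triple j k l) ⟧))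
  nbrsIn-triple χ = begin
    nbrsIn χ true (triple i j k)
      ≡⟨ countB≡sumOver _ S ⟩
    sumOver S (λ v → ⟦ isVertex v ∧ adjacent (triple i j k) v ∧ not (χ v xor true) ⟧)
      ≡⟨ sumOver-cong S (λ v → ⟦∧∧xor⟧ (isVertex v) (adjacent (triple i j k) v) (χ v)) ⟩
    sumOver S (λ v → ⟦ isVertex v ∧ adjacent (triple i j k) v ⟧ * ⟦ χ v ⟧)
      ≡⟨ sumOver-cong S (λ v → cong (_* ⟦ χ v ⟧) (neighbour-indicator v)) ⟩
    sumOver S (λ v → ∑[ l < n ] (⟦ out l ⟧ * E v l) * ⟦ χ v ⟧)
      ≡⟨ sumOver-cong S (λ v → *-distribʳ-sum ⟦ χ v ⟧ (λ l → ⟦ out l ⟧ * E v l)) ⟩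
    sumOver S (λ v → ∑[ l < n ] (⟦ out l ⟧ * E v l * ⟦ χ v ⟧))
      ≡⟨ sumOver-comm-∑ S (λ v l → ⟦ out l ⟧ * E v l * ⟦ χ v ⟧) ⟩
    ∑[ l < n ] sumOver S (λ v → ⟦ out l ⟧ * E v l * ⟦ χ v ⟧)
      ≡⟨ sum-cong-≗ per-l ⟩
    ∑[ l < n ] (⟦ out l ⟧ * (⟦ χ (triple i j l) ⟧ + ⟦ χ (triple i k l) ⟧ + ⟦ χ (triple j k l) ⟧)) ∎
    where
    S : List (Subset n)
    S = allSubsets n
    E : Subset n → Fin n → ℕ
    E v l = ⟦ v =ˢ triple i j l ⟧ + ⟦ v =ˢ triple i k l ⟧ + ⟦ v =ˢ triple j k l ⟧
    δ : Subset n → Subset n → ℕ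
    δ w v = ⟦ v =ˢ w ⟧ * ⟦ χ v ⟧
    distribute : ∀ o a b c x → o * (a + b + c) * x ≡ o * (a * x + b * x + c * x)
    distribute = solve-∀
    per-l : ∀ l → sumOver S (λ v → ⟦ out l ⟧ * E v l * ⟦ χ v ⟧) ≡
                 ⟦ out l ⟧ * (⟦ χ (triple i j l) ⟧ + ⟦ χ (triple i k l) ⟧ + ⟦ χ (triple j k l) ⟧)
    per-l l = begin
      sumOver S (λ v → ⟦ out l ⟧ * E v l * ⟦ χ v ⟧)
        ≡⟨ sumOver-cong S (λ v → distribute ⟦ out l ⟧ ⟦ v =ˢ ijl ⟧ ⟦ v =ˢ ikl ⟧ ⟦ v =ˢ jkl ⟧ ⟦ χ v ⟧) ⟩
      sumOver S (λ v → ⟦ out l ⟧ * (δ ijl v + δ ikl v + δ jkl v))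
        ≡⟨ *-distribˡ-sumOver ⟦ out l ⟧ S (λ v → δ ijl v + δ ikl v + δ jkl v) ⟨
      ⟦ out l ⟧ * sumOver S (λ v → δ ijl v + δ ikl v + δ jkl v)
        ≡⟨ cong (⟦ out l ⟧ *_) (trans (sumOver-distrib-+ S (λ v → δ ijl v + δ ikl v) (δ jkl))
                                      (cong (_+ sumOver S (δ jkl)) (sumOver-distrib-+ S (δ ijl) (δ ikl)))) ⟩
      ⟦ out l ⟧ * (sumOver S (δ ijl) + sumOver S (δ ikl) + sumOver S (δ jkl))
        ≡⟨ cong (⟦ out l ⟧ *_) (cong₂ _+_ (cong₂ _+_ (sumOver-allSubsets-δ ijl (⟦_⟧ ∘ χ))
                                                     (sumOver-allSubsets-δ ikl (⟦_⟧ ∘ χ)))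
                                          (sumOver-allSubsets-δ jkl (⟦_⟧ ∘ χ))) ⟩
      ⟦ out l ⟧ * (⟦ χ ijl ⟧ + ⟦ χ ikl ⟧ + ⟦ χ jkl ⟧) ∎
      where
      ijl = triple i j l
      ikl = triple i k l
      jkl = triple j k l

  card-triple : ∣ triple i j k ∣ ≡ 3
  card-triple = begin
    ∣ triple i j k ∣                     ≡⟨ cong ∣_∣ (∩-idem (triple i j k)) ⟨
    ∣ triple i j k ∩ triple i j k ∣      ≡⟨ card-∩ (triple i j k) ⟩
    inside-count (triple i j k)
      ≡⟨ cong₂ _+_ (cong₂ _+_ (∈u (hit₁ (==-refl i))) (∈u (hit₂ j==i (==-refl j)))) (∈u k∈) ⟩
    3 ∎
    where
    ∈u : ∀ {x} → (x == i ∨ x == j ∨ x == k) ≡ true → ⟦ lookup (triple i j k) x ⟧ ≡ 1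
    ∈u {x} hit = cong ⟦_⟧ (trans (lookup-triple i j k x) hit)
    k∈ : (k == i ∨ k == j ∨ k == k) ≡ true
    k∈ rewrite k==i | k==j = ==-refl k

  count-outside₃ : count out + 3 ≡ n
  count-outside₃ = begin
    count out + 3                          ≡⟨ +-comm (count out) 3 ⟩
    3 + count out                          ≡⟨ cong (3 +_) (sum-cong-≗ λ l → sym (*-identityʳ ⟦ out l ⟧)) ⟩
    1 + 1 + 1 + ∑[ l < n ] (⟦ out l ⟧ * 1) ≡⟨ sum-split₃ i≢j i≢k j≢k (λ _ → 1) ⟨
    ∑[ l < n ] 1                           ≡⟨ sum-one n ⟩
    n ∎

  module _ (χ : Subset n → Bool) where

    row : Fin n → Fin n → ℕ
    row x y = ∑[ l < n ] (⟦ out l ⟧ * ⟦ χ (triple x y l) ⟧)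

    private
      term : Fin n → Fin n → Fin n → ℕ
      term x y l = ⟦ not (l == x) ∧ not (l == y) ∧ χ (triple x y l) ⟧

      term-first : ∀ x y → term x y x ≡ 0
      term-first x y rewrite ==-refl x = refl

      term-second : ∀ x y → term x y y ≡ 0
      term-second x y rewrite ==-refl y with y == x
      ... | true = refl
      ... | false = refl

      term-other : ∀ x y {l} → l == x ≡ false → l == y ≡ false → term x y l ≡ ⟦ χ (triple x y l) ⟧
      term-other x y l≠x l≠y rewrite l≠x | l≠y = refl

      pairCount-split : ∀ x y → (∀ l → out l ≡ true → (l == x ≡ false) × (l == y ≡ false)) →
        pairCount χ x y ≡ term x y i + term x y j + term x y k + row x y
      pairCount-split x y xy = begin
        pairCount χ x y                          ≡⟨ countB-allFin n _ ⟩
        sum (term x y)                           ≡⟨ sum-split₃ i≢j i≢k j≢k (term x y) ⟩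
        term x y i + term x y j + term x y k + ∑[ l < n ] (⟦ out l ⟧ * term x y l)
          ≡⟨ cong (term x y i + term x y j + term x y k +_)
                  (sum-mask-cong out λ l ol → let l≠x , l≠y = xy l ol in term-other x y l≠x l≠y) ⟩
        term x y i + term x y j + term x y k + row x y ∎

    pairCount-ij : pairCount χ i j ≡ ⟦ χ (triple i j k) ⟧ + row i j
    pairCount-ij = trans (pairCount-split i j λ l ol → let open Outside (out⇒Outside l ol) in x==i , x==j)
      (cong (_+ row i j) (cong₂ _+_ (cong₂ _+_ (term-first i j) (term-second i j)) (term-other i j k==i k==j)))

    pairCount-ik : pairCount χ i k ≡ ⟦ χ (triple i j k) ⟧ + row i k
    pairCount-ik = trans (pairCount-split i k λ l ol → let open Outside (out⇒Outside l ol) in x==i , x==k)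
      (cong (_+ row i k) (trans (cong₂ _+_ (cong₂ _+_ (term-first i k) (trans (term-other i k j==i j==k) χ-ikj))
                                           (term-second i k))
                                (+-identityʳ _)))
      where
      χ-ikj : ⟦ χ (triple i k j) ⟧ ≡ ⟦ χ (triple i j k) ⟧
      χ-ikj = cong (⟦_⟧ ∘ χ) (triple-swap₂₃ i k j)

    pairCount-jk : pairCount χ j k ≡ ⟦ χ (triple i j k) ⟧ + row j k
    pairCount-jk = trans (pairCount-split j k λ l ol → let open Outside (out⇒Outside l ol) in x==j , x==k)
      (cong (_+ row j k) (trans (cong₂ _+_ (cong₂ _+_ (trans (term-other j k i==j i==k) χ-jki) (term-first j k))
                                           (term-second j k))
                                (trans (+-identityʳ _) (+-identityʳ _))))
      where
      χ-jki : ⟦ χ (triple j k i) ⟧ ≡ ⟦ χ (triple i j k) ⟧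
      χ-jki = cong (⟦_⟧ ∘ χ) (trans (triple-swap₂₃ j k i) (triple-swap₁₂ j i k))

    nbrsIn+3≡pairCounts : nbrsIn χ true (triple i j k) + 3 * ⟦ χ (triple i j k) ⟧ ≡
      pairCount χ i j + pairCount χ i k + pairCount χ j k
    nbrsIn+3≡pairCounts = begin
      nbrsIn χ true (triple i j k) + 3 * c
        ≡⟨ cong (_+ 3 * c) (nbrsIn-triple χ) ⟩
      ∑[ l < n ] (⟦ out l ⟧ * (a l + b l + d l)) + 3 * c
        ≡⟨ cong (_+ 3 * c) (trans (sum-cong-≗ λ l → *-distribˡ-+₃ ⟦ out l ⟧ (a l) (b l) (d l))
             (trans (∑-distrib-+ (λ l → ⟦ out l ⟧ * a l + ⟦ out l ⟧ * b l) (λ l → ⟦ out l ⟧ * d l))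
                    (cong (_+ row j k) (∑-distrib-+ (λ l → ⟦ out l ⟧ * a l) (λ l → ⟦ out l ⟧ * b l))))) ⟩
      row i j + row i k + row j k + 3 * c
        ≡⟨ regroup (row i j) (row i k) (row j k) c ⟩
      (c + row i j) + (c + row i k) + (c + row j k)
        ≡⟨ cong₂ _+_ (cong₂ _+_ pairCount-ij pairCount-ik) pairCount-jk ⟨
      pairCount χ i j + pairCount χ i k + pairCount χ j k ∎
      where
      c = ⟦ χ (triple i j k) ⟧
      a = λ l → ⟦ χ (triple i j l) ⟧
      b = λ l → ⟦ χ (triple i k l) ⟧
      d = λ l → ⟦ χ (triple j k l) ⟧
      *-distribˡ-+₃ : ∀ o x y z → o * (x + y + z) ≡ o * x + o * y + o * z
      *-distribˡ-+₃ = solve-∀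
      regroup : ∀ p q r c → p + q + r + 3 * c ≡ (c + p) + (c + q) + (c + r)
      regroup = solve-∀

-- The patterns C_d

_==³_ : Bool³ → Bool³ → Bool
(x , y , z) ==³ (x′ , y′ , z′) = (x ⇔ᵇ x′) ∧ (y ⇔ᵇ y′) ∧ (z ⇔ᵇ z′)

==³-refl : ∀ p → p ==³ p ≡ true
==³-refl (x , y , z) rewrite ⇔ᵇ-refl x | ⇔ᵇ-refl y | ⇔ᵇ-refl z = refl

==³⇒≡ : ∀ {p q} → p ==³ q ≡ true → p ≡ q
==³⇒≡ eq =
  let x≡ , yz≡ = ∧-≡-true eq
      y≡ , z≡ = ∧-≡-true yz≡
  in cong₂ _,_ (⇔ᵇ⇒≡ x≡) (cong₂ _,_ (⇔ᵇ⇒≡ y≡) (⇔ᵇ⇒≡ z≡))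

patterns : List Bool³
patterns = (true , true , true) ∷ (true , true , false) ∷ (true , false , true) ∷ (true , false , false) ∷
           (false , true , true) ∷ (false , true , false) ∷ (false , false , true) ∷ (false , false , false) ∷ []

sumOver-patterns-δ : ∀ q (g : Bool³ → ℕ) → sumOver patterns (λ p → ⟦ q ==³ p ⟧ * g p) ≡ g q
sumOver-patterns-δ (true , true , true) g = trans (+-identityʳ _) (+-identityʳ _)
sumOver-patterns-δ (true , true , false) g = trans (+-identityʳ _) (+-identityʳ _)
sumOver-patterns-δ (true , false , true) g = trans (+-identityʳ _) (+-identityʳ _)
sumOver-patterns-δ (true , false , false) g = trans (+-identityʳ _) (+-identityʳ _)
sumOver-patterns-δ (false , true , true) g = trans (+-identityʳ _) (+-identityʳ _)
sumOver-patterns-δ (false , true , false) g = trans (+-identityʳ _) (+-identityʳ _)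
sumOver-patterns-δ (false , false , true) g = trans (+-identityʳ _) (+-identityʳ _)
sumOver-patterns-δ (false , false , false) g = trans (+-identityʳ _) (+-identityʳ _)

sum-by-pattern : ∀ {n} (m : Fin n → Bool) (c : Fin n → Bool³) (g : Bool³ → ℕ) →
  ∑[ d < n ] (⟦ m d ⟧ * g (c d)) ≡ sumOver patterns (λ p → count (λ d → m d ∧ (c d ==³ p)) * g p)
sum-by-pattern {n} m c g = begin
  ∑[ d < n ] (⟦ m d ⟧ * g (c d))
    ≡⟨ sum-cong-≗ (λ d → split (m d) (c d)) ⟩
  ∑[ d < n ] sumOver patterns (λ p → ⟦ m d ∧ (c d ==³ p) ⟧ * g p)
    ≡⟨ sumOver-comm-∑ patterns (λ p d → ⟦ m d ∧ (c d ==³ p) ⟧ * g p) ⟨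
  sumOver patterns (λ p → ∑[ d < n ] (⟦ m d ∧ (c d ==³ p) ⟧ * g p))
    ≡⟨ sumOver-cong patterns (λ p → *-distribʳ-sum (g p) (λ d → ⟦ m d ∧ (c d ==³ p) ⟧)) ⟨
  sumOver patterns (λ p → count (λ d → m d ∧ (c d ==³ p)) * g p) ∎
  where
  split : ∀ b q → ⟦ b ⟧ * g q ≡ sumOver patterns (λ p → ⟦ b ∧ (q ==³ p) ⟧ * g p)
  split true q = trans (+-identityʳ (g q)) (sym (sumOver-patterns-δ q g))
  split false q = refl

-- Equitable 2-partitions

module Partition {n : ℕ} (χ : Subset n → Bool) {p11 p12 p21 p22 : ℕ}
  (equitable : IsEquitable χ p11 p12 p21 p22) (λ₂ : p11 + 7 ≡ p21 + n) (K : ℕ) (n≡ : n ≡ K + 4) where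

  p11+3≡ : p11 + 3 ≡ p21 + K
  p11+3≡ = +-cancelʳ-≡ 4 _ _ (begin
    p11 + 3 + 4      ≡⟨ +-assoc p11 3 4 ⟩
    p11 + 7          ≡⟨ λ₂ ⟩
    p21 + n          ≡⟨ cong (p21 +_) n≡ ⟩
    p21 + (K + 4)    ≡⟨ +-assoc p21 K 4 ⟨
    p21 + K + 4      ∎)

  vertex-in : ∀ {x y z} → x ≢ y → x ≢ z → y ≢ z → χ (triple x y z) ≡ true →
    pairCount χ x y + pairCount χ x z + pairCount χ y z ≡ p21 + K
  vertex-in {x} {y} {z} x≢y x≢z y≢z inX₁ = begin
    pairCount χ x y + pairCount χ x z + pairCount χ y z
      ≡⟨ nbrsIn+3≡pairCounts χ ⟨
    nbrsIn χ true (triple x y z) + 3 * ⟦ χ (triple x y z) ⟧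
      ≡⟨ cong₂ (λ m b → m + 3 * ⟦ b ⟧) (proj₁ (proj₁ equitable (triple x y z) card-triple inX₁)) inX₁ ⟩
    p11 + 3
      ≡⟨ p11+3≡ ⟩
    p21 + K ∎
    where
    open Triple x≢y x≢z y≢z

  vertex-out : ∀ {x y z} → x ≢ y → x ≢ z → y ≢ z → χ (triple x y z) ≡ false →
    pairCount χ x y + pairCount χ x z + pairCount χ y z ≡ p21
  vertex-out {x} {y} {z} x≢y x≢z y≢z inX₂ = begin
    pairCount χ x y + pairCount χ x z + pairCount χ y z
      ≡⟨ nbrsIn+3≡pairCounts χ ⟨
    nbrsIn χ true (triple x y z) + 3 * ⟦ χ (triple x y z) ⟧
      ≡⟨ cong₂ (λ m b → m + 3 * ⟦ b ⟧) (proj₁ (proj₂ equitable (triple x y z) card-triple inX₂)) inX₂ ⟩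
    p21 + 0
      ≡⟨ +-identityʳ p21 ⟩
    p21 ∎
    where
    open Triple x≢y x≢z y≢z

  module AtVertex {a b c : Fin n} (a≢b : a ≢ b) (a≢c : a ≢ c) (b≢c : b ≢ c)
    (abc∈X₁ : χ (triple a b c) ≡ true)
    (ab≡ac : pairCount χ a b ≡ pairCount χ a c) (ac≡bc : pairCount χ a c ≡ pairCount χ b c)
    (2n≤ : 2 * n ≤ p11 + 7) where

    s : ℕ
    s = pairCount χ a b

    ac≡s : pairCount χ a c ≡ s
    ac≡s = sym ab≡ac

    bc≡s : pairCount χ b c ≡ s
    bc≡s = trans (sym ac≡bc) ac≡s

    triangle : 3 * s ≡ p21 + K
    triangle = begin
      3 * s                                               ≡⟨ tripled s ⟩
      s + s + s                                           ≡⟨ cong₂ (λ x y → s + x + y) ac≡s bc≡s ⟨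
      pairCount χ a b + pairCount χ a c + pairCount χ b c ≡⟨ vertex-in a≢b a≢c b≢c abc∈X₁ ⟩
      p21 + K                                             ∎
      where
      tripled : ∀ s → 3 * s ≡ s + s + s
      tripled = solve-∀

    large-s : 2 * K + 4 ≤ 3 * s
    large-s = large-pair-count {n} {K} {p11} {s} n≡ 2n≤ (trans p11+3≡ (sym triangle))

    module _ {d : Fin n} (d-out : Outside3 a b c d) where

      private
        a≢d : a ≢ d
        a≢d = proj₁ d-out ∘ sym
        b≢d : b ≢ d
        b≢d = proj₁ (proj₂ d-out) ∘ sym
        c≢d : c ≢ d
        c≢d = proj₂ (proj₂ d-out) ∘ sym

        α β γ : ℕ
        α = pairCount χ a d
        β = pairCount χ b d
        γ = pairCount χ c d

        abd-in : χ (triple a b d) ≡ true → s + α + β ≡ p21 + K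
        abd-in = vertex-in a≢b a≢d b≢d
        abd-out : χ (triple a b d) ≡ false → s + α + β ≡ p21
        abd-out = vertex-out a≢b a≢d b≢d
        acd-in : χ (triple a c d) ≡ true → s + α + γ ≡ p21 + K
        acd-in e = trans (cong (λ x → x + α + γ) (sym ac≡s)) (vertex-in a≢c a≢d c≢d e)
        acd-out : χ (triple a c d) ≡ false → s + α + γ ≡ p21
        acd-out e = trans (cong (λ x → x + α + γ) (sym ac≡s)) (vertex-out a≢c a≢d c≢d e)
        bcd-in : χ (triple b c d) ≡ true → s + β + γ ≡ p21 + K
        bcd-in e = trans (cong (λ x → x + β + γ) (sym bc≡s)) (vertex-in b≢c b≢d c≢d e)
        bcd-out : χ (triple b c d) ≡ false → s + β + γ ≡ p21
        bcd-out e = trans (cong (λ x → x + β + γ) (sym bc≡s)) (vertex-out b≢c b≢d c≢d e)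

        swap : ∀ {x y r} → s + x + y ≡ r → s + y + x ≡ r
        swap {x} {y} e = trans (xy∙z≈xz∙y s y x) e

        saturated : ∀ {x y} → x ≢ y → 2 * pairCount χ x y ≡ 2 * s + K → pairCount χ x y + 2 ≡ n × 2 * s ≡ K + 4
        saturated {x} {y} x≢y doubled =
          let bounded = subst (pairCount χ x y + 2 ≤_) (trans n≡ (sym (+-assoc K 2 2))) (pairCount-≤ χ x≢y)
              full , 2s≡ = double-saturated s K (pairCount χ x y) doubled (+-cancelʳ-≤ 2 _ _ bounded) large-s
          in trans (cong (_+ 2) full) (trans (+-assoc K 2 2) (sym n≡)) , 2s≡

        abd≡ : ∀ {x y z} → C χ a b c d ≡ (x , y , z) → χ (triple a b d) ≡ x
        abd≡ = cong proj₁
        acd≡ : ∀ {x y z} → C χ a b c d ≡ (x , y , z) → χ (triple a c d) ≡ y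
        acd≡ = cong (proj₁ ∘ proj₂)
        bcd≡ : ∀ {x y z} → C χ a b c d ≡ (x , y , z) → χ (triple b c d) ≡ z
        bcd≡ = cong (proj₂ ∘ proj₂)

      single₁ : C χ a b c d ≡ (true , false , false) → γ + K ≡ s
      single₁ Cd = single-vertex s p21 K α β γ triangle
        (acd-out (acd≡ Cd)) (bcd-out (bcd≡ Cd)) (abd-in (abd≡ Cd))

      single₂ : C χ a b c d ≡ (false , true , false) → β + K ≡ s
      single₂ Cd = single-vertex s p21 K α γ β triangle
        (abd-out (abd≡ Cd)) (swap (bcd-out (bcd≡ Cd))) (acd-in (acd≡ Cd))

      single₃ : C χ a b c d ≡ (false , false , true) → α + K ≡ s
      single₃ Cd = single-vertex s p21 K β γ α triangle
        (swap (abd-out (abd≡ Cd))) (swap (acd-out (acd≡ Cd))) (bcd-in (bcd≡ Cd))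

      double₁ : C χ a b c d ≡ (false , true , true) → γ + 2 ≡ n × 2 * s ≡ K + 4
      double₁ Cd = saturated c≢d (double-vertex s p21 K α β γ triangle
        (abd-out (abd≡ Cd)) (acd-in (acd≡ Cd)) (bcd-in (bcd≡ Cd)))

      double₂ : C χ a b c d ≡ (true , false , true) → β + 2 ≡ n × 2 * s ≡ K + 4
      double₂ Cd = saturated b≢d (double-vertex s p21 K α γ β triangle
        (acd-out (acd≡ Cd)) (abd-in (abd≡ Cd)) (swap (bcd-in (bcd≡ Cd))))

      double₃ : C χ a b c d ≡ (true , true , false) → α + 2 ≡ n × 2 * s ≡ K + 4
      double₃ Cd = saturated a≢d (double-vertex s p21 K β γ α triangle
        (bcd-out (bcd≡ Cd)) (swap (abd-in (abd≡ Cd))) (swap (acd-in (acd≡ Cd))))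

    out : Fin n → Bool
    out = outside₃ a b c

    N : Bool³ → ℕ
    N p = count (λ d → out d ∧ (C χ a b c d ==³ p))

    t z u₁ u₂ u₃ w₁ w₂ w₃ : ℕ
    t = N (true , true , true)
    z = N (false , false , false)
    u₁ = N (true , false , false)
    u₂ = N (false , true , false)
    u₃ = N (false , false , true)
    w₁ = N (false , true , true)
    w₂ = N (true , false , true)
    w₃ = N (true , true , false)

    private
      by-pattern : ∀ (g : Bool³ → ℕ) →
        ∑[ d < n ] (⟦ out d ⟧ * g (C χ a b c d)) ≡ sumOver patterns (λ p → N p * g p)
      by-pattern = sum-by-pattern out (C χ a b c)

      open Triple a≢b a≢c b≢c using (row; pairCount-ij; pairCount-ik; pairCount-jk; count-outside₃)

      expand₁ : ∀ t w₃ w₂ u₁ w₁ u₂ u₃ z →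
        t * 1 + (w₃ * 1 + (w₂ * 1 + (u₁ * 1 + (w₁ * 0 + (u₂ * 0 + (u₃ * 0 + (z * 0 + 0))))))) ≡ t + u₁ + w₂ + w₃
      expand₁ = solve-∀
      expand₂ : ∀ t w₃ w₂ u₁ w₁ u₂ u₃ z →
        t * 1 + (w₃ * 1 + (w₂ * 0 + (u₁ * 0 + (w₁ * 1 + (u₂ * 1 + (u₃ * 0 + (z * 0 + 0))))))) ≡ t + u₂ + w₁ + w₃
      expand₂ = solve-∀
      expand₃ : ∀ t w₃ w₂ u₁ w₁ u₂ u₃ z →
        t * 1 + (w₃ * 0 + (w₂ * 1 + (u₁ * 0 + (w₁ * 1 + (u₂ * 0 + (u₃ * 1 + (z * 0 + 0))))))) ≡ t + u₃ + w₁ + w₂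
      expand₃ = solve-∀
      expand-all : ∀ t w₃ w₂ u₁ w₁ u₂ u₃ z →
        t * 1 + (w₃ * 1 + (w₂ * 1 + (u₁ * 1 + (w₁ * 1 + (u₂ * 1 + (u₃ * 1 + (z * 1 + 0))))))) ≡
        t + z + u₁ + u₂ + u₃ + w₁ + w₂ + w₃
      expand-all = solve-∀

      pair-count : ∀ {x y} (g : Bool³ → ℕ) → pairCount χ x y ≡ ⟦ χ (triple a b c) ⟧ + row χ x y →
        row χ x y ≡ ∑[ d < n ] (⟦ out d ⟧ * g (C χ a b c d)) → ∀ {m} → sumOver patterns (λ p → N p * g p) ≡ m →
        pairCount χ x y ≡ suc m
      pair-count g split row≡ expand = trans split (cong₂ _+_ (cong ⟦_⟧ abc∈X₁) (trans row≡ (trans (by-pattern g) expand)))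

    pair₁ : suc (t + u₁ + w₂ + w₃) ≡ s
    pair₁ = sym (pair-count (λ p → ⟦ proj₁ p ⟧) (pairCount-ij χ) refl (expand₁ t w₃ w₂ u₁ w₁ u₂ u₃ z))

    pair₂ : suc (t + u₂ + w₁ + w₃) ≡ s
    pair₂ = trans (sym (pair-count (λ p → ⟦ proj₁ (proj₂ p) ⟧) (pairCount-ik χ) refl (expand₂ t w₃ w₂ u₁ w₁ u₂ u₃ z))) ac≡s

    pair₃ : suc (t + u₃ + w₁ + w₂) ≡ s
    pair₃ = trans (sym (pair-count (λ p → ⟦ proj₂ (proj₂ p) ⟧) (pairCount-jk χ) refl (expand₃ t w₃ w₂ u₁ w₁ u₂ u₃ z))) bc≡s

    total : t + z + u₁ + u₂ + u₃ + w₁ + w₂ + w₃ ≡ suc K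
    total = +-cancelʳ-≡ 3 _ _ (begin
      t + z + u₁ + u₂ + u₃ + w₁ + w₂ + w₃ + 3
        ≡⟨ cong (_+ 3) (expand-all t w₃ w₂ u₁ w₁ u₂ u₃ z) ⟨
      sumOver patterns (λ p → N p * 1) + 3
        ≡⟨ cong (_+ 3) (by-pattern (λ _ → 1)) ⟨
      ∑[ d < n ] (⟦ out d ⟧ * 1) + 3
        ≡⟨ cong (_+ 3) (sum-cong-≗ λ d → *-identityʳ ⟦ out d ⟧) ⟩
      count out + 3
        ≡⟨ trans count-outside₃ n≡ ⟩
      K + 4
        ≡⟨ +-suc K 3 ⟩
      suc K + 3 ∎)

    private
      Outside3⇒out : ∀ {d} → Outside3 a b c d → out d ≡ true
      Outside3⇒out (d≢a , d≢b , d≢c) rewrite ≢⇒==false d≢a | ≢⇒==false d≢b | ≢⇒==false d≢c = refl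

      out⇒Outside3 : ∀ {d} → out d ≡ true → Outside3 a b c d
      out⇒Outside3 {d} od =
        let d≠a , rest = ∧-≡-true od
            d≠b , d≠c = ∧-≡-true rest
        in ==false⇒≢ (not-injective d≠a) , ==false⇒≢ (not-injective d≠b) , ==false⇒≢ (not-injective d≠c)

      occurs : ∀ {d p} → Outside3 a b c d → C χ a b c d ≡ p → (out d ∧ (C χ a b c d ==³ p)) ≡ true
      occurs {p = p} d-out Cd = cong₂ _∧_ (Outside3⇒out d-out) (trans (cong (_==³ p) Cd) (==³-refl p))

    found : ∀ p → 0 < N p → ∃ λ d → Outside3 a b c d × C χ a b c d ≡ p
    found p pos =
      let d , hit = count-pos⇒ _ pos
          od , Cd = ∧-≡-true hit
      in d , out⇒Outside3 od , ==³⇒≡ Cd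

    absent : ∀ {p} → N p ≡ 0 → ∀ g → Outside3 a b c g → C χ a b c g ≢ p
    absent none g g-out Cg =
      contradiction (count-zero⇒ _ none g) (λ miss → true≢false (trans (sym (occurs g-out Cg)) miss))
      where
      true≢false : true ≢ false
      true≢false ()

    unique : ∀ {p d} → N p ≡ 1 → Outside3 a b c d → C χ a b c d ≡ p →
      ∀ g → Outside3 a b c g → g ≢ d → C χ a b c g ≢ p
    unique one d-out Cd g g-out g≢d Cg = g≢d (count-one⇒ _ one (occurs g-out Cg) (occurs d-out Cd))

    witness : ∀ {p} → N p ≡ 1 → ∃ λ d → Outside3 a b c d × C χ a b c d ≡ p
    witness {p} one = found p (subst (0 <_) (sym one) (s≤s z≤n))

    private
      distinct : ∀ {d e p p′} → C χ a b c d ≡ p → C χ a b c e ≡ p′ → p ≢ p′ → d ≢ e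
      distinct Cd Ce p≢p′ refl = p≢p′ (trans (sym Cd) Ce)

      -- (o,e)* = 0 forbids {o,d,e} ∈ X₁, while (o,d)* = n − 2 forces it.
      clash : ∀ {o d e} → d ≢ e → o ≢ d → o ≢ e →
        s ≡ K → pairCount χ o e + K ≡ s → pairCount χ o d + 2 ≡ n → ⊥
      clash {o} {d} {e} d≢e o≢d o≢e s≡K single double = true≢false (begin
        true                   ≡⟨ pairCount-full χ o≢d double e (o≢e ∘ sym) (d≢e ∘ sym) ⟨
        χ (triple o d e)       ≡⟨ cong χ (triple-swap₂₃ o d e) ⟩
        χ (triple o e d)       ≡⟨ pairCount-zero χ empty d (o≢d ∘ sym) d≢e ⟩
        false                  ∎)
        where
        true≢false : true ≢ false
        true≢false ()
        empty : pairCount χ o e ≡ 0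
        empty = +-cancelʳ-≡ K _ 0 (trans single s≡K)

    constraints : Constraints K s t z u₁ u₂ u₃ w₁ w₂ w₃
    constraints = record
      { total = total
      ; pair₁ = pair₁
      ; pair₂ = pair₂
      ; pair₃ = pair₃
      ; large = large-s
      ; single₁ = λ pos → let _ , d-out , Cd = found _ pos in subst (K ≤_) (single₁ d-out Cd) (m≤n+m K _)
      ; single₂ = λ pos → let _ , d-out , Cd = found _ pos in subst (K ≤_) (single₂ d-out Cd) (m≤n+m K _)
      ; single₃ = λ pos → let _ , d-out , Cd = found _ pos in subst (K ≤_) (single₃ d-out Cd) (m≤n+m K _)
      ; double₁ = λ pos → let _ , d-out , Cd = found _ pos in proj₂ (double₁ d-out Cd)
      ; double₂ = λ pos → let _ , d-out , Cd = found _ pos in proj₂ (double₂ d-out Cd)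
      ; double₃ = λ pos → let _ , d-out , Cd = found _ pos in proj₂ (double₃ d-out Cd)
      ; clash₁ = λ s≡K pu pw →
          let e , e-out , Ce = found _ pu ; d , d-out , Cd = found _ pw
          in clash (distinct Cd Ce λ ()) (proj₂ (proj₂ d-out) ∘ sym) (proj₂ (proj₂ e-out) ∘ sym)
                   s≡K (single₁ e-out Ce) (proj₁ (double₁ d-out Cd))
      ; clash₂ = λ s≡K pu pw →
          let e , e-out , Ce = found _ pu ; d , d-out , Cd = found _ pw
          in clash (distinct Cd Ce λ ()) (proj₁ (proj₂ d-out) ∘ sym) (proj₁ (proj₂ e-out) ∘ sym)
                   s≡K (single₂ e-out Ce) (proj₁ (double₂ d-out Cd))
      ; clash₃ = λ s≡K pu pw →
          let e , e-out , Ce = found _ pu ; d , d-out , Cd = found _ pw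
          in clash (distinct Cd Ce λ ()) (proj₁ d-out ∘ sym) (proj₁ e-out ∘ sym)
                   s≡K (single₃ e-out Ce) (proj₁ (double₃ d-out Cd))
      }

    Conclusion : Set
    Conclusion =
      ((d : Fin n) → Outside3 a b c d → Constant (C χ a b c d))
      ⊎
      (∃ λ d → ∃ λ e → Outside3 a b c d × Outside3 a b c e × d ≢ e ×
        TwoOnes (C χ a b c d) × C χ a b c e ≡ complement³ (C χ a b c d) ×
        ((f : Fin n) → Outside3 a b c f → f ≢ d → f ≢ e → Constant (C χ a b c f)))
      ⊎
      (∃ λ d → ∃ λ e → ∃ λ f →
        Outside3 a b c d × Outside3 a b c e × Outside3 a b c f ×
        d ≢ e × d ≢ f × e ≢ f ×
        C χ a b c d ≡ (true , false , false) ×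
        C χ a b c e ≡ (false , true , false) ×
        C χ a b c f ≡ (false , false , true) ×
        ((g : Fin n) → Outside3 a b c g → g ≢ d → g ≢ e → g ≢ f → Constant (C χ a b c g)))
      ⊎
      (∃ λ d → ∃ λ e → ∃ λ f →
        Outside3 a b c d × Outside3 a b c e × Outside3 a b c f ×
        d ≢ e × d ≢ f × e ≢ f ×
        C χ a b c d ≡ (true , true , false) ×
        C χ a b c e ≡ (true , false , true) ×
        C χ a b c f ≡ (false , true , true) ×
        ((g : Fin n) → Outside3 a b c g → g ≢ d → g ≢ e → g ≢ f → Constant (C χ a b c g)))

    private
      constant-unless : ∀ x → x ≢ (true , false , false) → x ≢ (false , true , false) → x ≢ (false , false , true) →
        x ≢ (false , true , true) → x ≢ (true , false , true) → x ≢ (true , true , false) → Constant x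
      constant-unless (true , true , true) _ _ _ _ _ _ = inj₁ refl
      constant-unless (false , false , false) _ _ _ _ _ _ = inj₂ refl
      constant-unless (true , false , false) ≢₁ _ _ _ _ _ = contradiction refl ≢₁
      constant-unless (false , true , false) _ ≢₂ _ _ _ _ = contradiction refl ≢₂
      constant-unless (false , false , true) _ _ ≢₃ _ _ _ = contradiction refl ≢₃
      constant-unless (false , true , true) _ _ _ ≢₄ _ _ = contradiction refl ≢₄
      constant-unless (true , false , true) _ _ _ _ ≢₅ _ = contradiction refl ≢₅
      constant-unless (true , true , false) _ _ _ _ _ ≢₆ = contradiction refl ≢₆

    conclusion : Shape u₁ u₂ u₃ w₁ w₂ w₃ → Conclusion
    conclusion (all-constant u₁≡0 u₂≡0 u₃≡0 w₁≡0 w₂≡0 w₃≡0) = inj₁ λ g g-out →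
      constant-unless _ (absent u₁≡0 g g-out) (absent u₂≡0 g g-out) (absent u₃≡0 g g-out)
                        (absent w₁≡0 g g-out) (absent w₂≡0 g g-out) (absent w₃≡0 g g-out)
    conclusion (complementary₁ u₁≡1 u₂≡0 u₃≡0 w₁≡1 w₂≡0 w₃≡0) =
      let d , d-out , Cd = witness w₁≡1 ; e , e-out , Ce = witness u₁≡1 in
      inj₂ (inj₁ (d , e , d-out , e-out , distinct Cd Ce (λ ()) , inj₂ (inj₂ Cd) , trans Ce (cong complement³ (sym Cd)) ,
        λ f f-out f≢d f≢e → constant-unless _ (unique u₁≡1 e-out Ce f f-out f≢e) (absent u₂≡0 f f-out) (absent u₃≡0 f f-out)
                                              (unique w₁≡1 d-out Cd f f-out f≢d) (absent w₂≡0 f f-out) (absent w₃≡0 f f-out)))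
    conclusion (complementary₂ u₁≡0 u₂≡1 u₃≡0 w₁≡0 w₂≡1 w₃≡0) =
      let d , d-out , Cd = witness w₂≡1 ; e , e-out , Ce = witness u₂≡1 in
      inj₂ (inj₁ (d , e , d-out , e-out , distinct Cd Ce (λ ()) , inj₂ (inj₁ Cd) , trans Ce (cong complement³ (sym Cd)) ,
        λ f f-out f≢d f≢e → constant-unless _ (absent u₁≡0 f f-out) (unique u₂≡1 e-out Ce f f-out f≢e) (absent u₃≡0 f f-out)
                                              (absent w₁≡0 f f-out) (unique w₂≡1 d-out Cd f f-out f≢d) (absent w₃≡0 f f-out)))
    conclusion (complementary₃ u₁≡0 u₂≡0 u₃≡1 w₁≡0 w₂≡0 w₃≡1) =
      let d , d-out , Cd = witness w₃≡1 ; e , e-out , Ce = witness u₃≡1 in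
      inj₂ (inj₁ (d , e , d-out , e-out , distinct Cd Ce (λ ()) , inj₁ Cd , trans Ce (cong complement³ (sym Cd)) ,
        λ f f-out f≢d f≢e → constant-unless _ (absent u₁≡0 f f-out) (absent u₂≡0 f f-out) (unique u₃≡1 e-out Ce f f-out f≢e)
                                              (absent w₁≡0 f f-out) (absent w₂≡0 f f-out) (unique w₃≡1 d-out Cd f f-out f≢d)))
    conclusion (three-singles u₁≡1 u₂≡1 u₃≡1 w₁≡0 w₂≡0 w₃≡0) =
      let d , d-out , Cd = witness u₁≡1 ; e , e-out , Ce = witness u₂≡1 ; f , f-out , Cf = witness u₃≡1 in
      inj₂ (inj₂ (inj₁ (d , e , f , d-out , e-out , f-out ,
        distinct Cd Ce (λ ()) , distinct Cd Cf (λ ()) , distinct Ce Cf (λ ()) , Cd , Ce , Cf ,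
        λ g g-out g≢d g≢e g≢f → constant-unless _
          (unique u₁≡1 d-out Cd g g-out g≢d) (unique u₂≡1 e-out Ce g g-out g≢e) (unique u₃≡1 f-out Cf g g-out g≢f)
          (absent w₁≡0 g g-out) (absent w₂≡0 g g-out) (absent w₃≡0 g g-out))))
    conclusion (three-doubles u₁≡0 u₂≡0 u₃≡0 w₁≡1 w₂≡1 w₃≡1) =
      let d , d-out , Cd = witness w₃≡1 ; e , e-out , Ce = witness w₂≡1 ; f , f-out , Cf = witness w₁≡1 in
      inj₂ (inj₂ (inj₂ (d , e , f , d-out , e-out , f-out ,
        distinct Cd Ce (λ ()) , distinct Cd Cf (λ ()) , distinct Ce Cf (λ ()) , Cd , Ce , Cf ,
        λ g g-out g≢d g≢e g≢f → constant-unless _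
          (absent u₁≡0 g g-out) (absent u₂≡0 g g-out) (absent u₃≡0 g g-out)
          (unique w₁≡1 f-out Cf g g-out g≢f) (unique w₂≡1 e-out Ce g g-out g≢e) (unique w₃≡1 d-out Cd g g-out g≢d))))

mainTheorem14 : (n : ℕ) → 6 ≤ n →
    (χ : Subset n → Bool) → IsTwoPartition χ →
    (p11 p12 p21 p22 : ℕ) → IsEquitable χ p11 p12 p21 p22 →
    p11 + 7 ≡ p21 + n →
    p22 ≤ p11 →
    2 * n ≤ p11 + 7 →
    (a b c : Fin n) → a ≢ b → a ≢ c → b ≢ c →
    χ (triple a b c) ≡ true →
    pairCount χ a b ≡ pairCount χ a c →
    pairCount χ a c ≡ pairCount χ b c →
    ((d : Fin n) → Outside3 a b c d → Constant (C χ a b c d))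
    ⊎
    (∃ λ d → ∃ λ e → Outside3 a b c d × Outside3 a b c e × d ≢ e ×
    TwoOnes (C χ a b c d) × C χ a b c e ≡ complement³ (C χ a b c d) ×
    ((f : Fin n) → Outside3 a b c f → f ≢ d → f ≢ e → Constant (C χ a b c f)))
    ⊎
    (∃ λ d → ∃ λ e → ∃ λ f →
    Outside3 a b c d × Outside3 a b c e × Outside3 a b c f ×
    d ≢ e × d ≢ f × e ≢ f ×
    C χ a b c d ≡ (true , false , false) ×
    C χ a b c e ≡ (false , true , false) ×
    C χ a b c f ≡ (false , false , true) ×
    ((g : Fin n) → Outside3 a b c g → g ≢ d → g ≢ e → g ≢ f → Constant (C χ a b c g)))
    ⊎
    (∃ λ d → ∃ λ e → ∃ λ f →
    Outside3 a b c d × Outside3 a b c e × Outside3 a b c f ×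
    d ≢ e × d ≢ f × e ≢ f ×
    C χ a b c d ≡ (true , true , false) ×
    C χ a b c e ≡ (true , false , true) ×
    C χ a b c f ≡ (false , true , true) ×
    ((g : Fin n) → Outside3 a b c g → g ≢ d → g ≢ e → g ≢ f → Constant (C χ a b c g)))
mainTheorem14 n 6≤n χ _ p11 p12 p21 p22 equitable λ₂ _ 2n≤ a b c a≢b a≢c b≢c abc∈X₁ ab≡ac ac≡bc =
  conclusion (classify constraints)
  where
  open Partition χ equitable λ₂ (n ∸ 4) (sym (m∸n+n≡m (≤-trans (s≤s (s≤s (s≤s (s≤s z≤n)))) 6≤n)))
  open AtVertex a≢b a≢c b≢c abc∈X₁ ab≡ac ac≡bc 2n≤
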